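{- For every positive integer $N$, \[ \sum_{\substack{\pi\in\mathcal{P}_e\\ |\pi|=N}} (-1)^{\nu_e(\pi)+1} \;=\; \chi(N \text{ is not a triangular number}). \]
   Context: A partition is a finite non-increasing sequence of positive integers (its parts); $|\pi|$ is the sum of its parts. $\mathcal{P}_e$ is the set of non-empty partitions in which every even part size occurs at most once (odd parts may repeat) and whose smallest part is even. $\nu_e(\pi)$ is the number of even parts of $\pi$. A triangular number is an integer of the form $k(k+1)/2$ with $k\ge 0$ an integer. $\chi(S)$ is $1$ if the statement $S$ is true and $0$ otherwise. -}

module Defs where

open import Data.Nat using (ℕ; zero; suc; _+_; _*_; _≤_; _≥_)
open import Data.Nat.Properties using (_≟_)
open import Data.Nat.Divisibility using (_∣_; _∣?_)
open import Data.Integer using (ℤ; +_; -_) renaming (_+_ to _+ℤ_)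
open import Data.Nat.ListAction using (sum)
open import Data.List using (List; []; _∷_; filter; length; last)
open import Data.List.Relation.Unary.All using (All)
open import Data.List.Relation.Unary.Linked using (Linked)
open import Data.Maybe using (just)
open import Data.Product using (_×_; ∃-syntax)
open import Relation.Binary.PropositionalEquality using (_≡_)

IsPartition : List ℕ → Set
IsPartition π = Linked _≥_ π × All (λ p → 1 ≤ p) π

∣_∣ₚ : List ℕ → ℕ
∣ π ∣ₚ = sum π

mult : ℕ → List ℕ → ℕ
mult p π = length (filter (p ≟_) π)

νₑ : List ℕ → ℕ
νₑ π = length (filter (2 ∣?_) π)

-- π ∈ 𝒫ₑ : non-empty partition, every even part size occurs at most once,
-- smallest part (= last part, since π is non-increasing) is even.
InPₑ : List ℕ → Set
InPₑ π = IsPartition π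
       × (∀ p → 2 ∣ p → mult p π ≤ 1)
       × (∃[ m ] (last π ≡ just m × 2 ∣ m))

sgn : ℕ → ℤ
sgn zero = + 1
sgn (suc n) = - sgn n

signedSum : List (List ℕ) → ℤ
signedSum [] = + 0
signedSum (π ∷ ps) = sgn (suc (νₑ π)) +ℤ signedSum ps

-- N is triangular: N = k(k+1)/2 for some k ≥ 0, i.e. 2N = k(k+1)
Triangular : ℕ → Set
Triangular N = ∃[ k ] 2 * N ≡ k * suc k

-- Let V_b = ∑ (-1)^(νₑ(π)+1) q^|π| over the π ∈ 𝒫ₑ whose parts are all ≤ b. Sorting by the largest
-- part b+1: if b+1 is odd it may be repeated, so V_{b+1} = V_b / (1 - q^(b+1)); if b+1 is even it occurs
-- once and flips the sign, or is the whole partition, so V_{b+1} = (1 - q^(b+1)) V_b + q^(b+1).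
-- The Gauss products G_b = ∏_{k ≤ b} (1 - q^k)^(±1), with + exactly for even k, obey the same
-- recurrences without the term q^(b+1), and induction gives V_b + G_b = 1/(1 - q) for odd b.
-- By Gauss's identity G_b → ∑ₜ q^(t(t+1)/2), so the coefficient of q^N in V_b (b > N) is
-- 1 - χ(N triangular). Gauss's identity itself is (q;q)_∞ (-q;q)_∞² = ∑ₜ q^(t(t+1)/2), using Euler's
-- (-q;q)_∞ = 1/(q;q²)_∞; it is obtained as the limit of a parity-filtered finite Jacobi triple product
-- ∑_{a ≡ k (mod 2)} q^(T(a-k)) [m a] = (-q;q)_{k-1} (-q;q)_{m-k}, T(d) = d(d+1)/2,
-- which follows from Pascal's rule for the Gaussian binomials [m a] by induction on m.

module Submission where

open import Defs
open import Data.Empty using (⊥-elim)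
open import Data.Integer using (ℤ; +_; -[1+_]; +[1+_]; -_; 0ℤ; 1ℤ) renaming (_+_ to _+ℤ_; _-_ to _-ℤ_)
import Data.Integer.Properties as ℤₚ
open import Data.Integer.Solver using (module +-*-Solver)
open import Data.List using (List; []; _∷_; [_]; _++_; map; length)
open import Data.List.Membership.Propositional using (_∈_)
open import Data.List.Membership.Propositional.Properties using (∈-++⁻; ∈-++⁺ˡ; ∈-++⁺ʳ; ∈-map⁺; ∈-map⁻)
open import Data.List.Membership.Propositional.Properties.WithK using (unique∧set⇒bag)
open import Data.List.Properties using (filter-accept; filter-reject; length-filter; ∷-injectiveʳ)
open import Data.List.Relation.Binary.BagAndSetEquality using (∼bag⇒↭)
open import Data.List.Relation.Binary.Disjoint.Propositional using (Disjoint)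
open import Data.List.Relation.Binary.Permutation.Propositional as ↭ using (_↭_)
open import Data.List.Relation.Unary.All as All using (All; []; _∷_)
open import Data.List.Relation.Unary.AllPairs using ([]; _∷_)
open import Data.List.Relation.Unary.Any using (here)
open import Data.List.Relation.Unary.Linked using ([-]; _∷_)
open import Data.List.Relation.Unary.Unique.Propositional using (Unique)
open import Data.List.Relation.Unary.Unique.Propositional.Properties using (++⁺; map⁺)
open import Data.Nat using (ℕ; zero; suc; _+_; _*_; _∸_; _≤_; _<_; _≥_; _≤?_; z≤n; s≤s)
open import Data.Nat.Base using (parity)
import Data.Nat.Properties as ℕₚ
import Data.Nat.Solver as ℕSolver
open import Data.Nat.Divisibility using (_∣_; _∣?_; divides)
open import Data.Nat.ListAction using (sum)
open import Data.Parity.Base using (Parity; 0ℙ; 1ℙ) renaming (_+_ to _+ℙ_)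
open import Data.Parity.Properties using (+-homo-+; p+p≡0ℙ)
open import Data.Product using (∃; ∃-syntax; _×_; _,_)
open import Data.Sum using (_⊎_; inj₁; inj₂)
open import Function using (_∘_)
open import Function.Bundles using (_⇔_; mk⇔; Equivalence)
open import Relation.Binary.Bundles using (Setoid)
open import Relation.Binary.Definitions using (tri<; tri≈; tri>)
open import Relation.Binary.PropositionalEquality hiding ([_])
import Relation.Binary.Reasoning.Setoid as SetoidReasoning
open import Relation.Nullary using (¬_; Dec; yes; no)
open import Relation.Nullary.Negation using (contradiction)
open +-*-Solver using (solve; _:+_; _:-_; :-_; _:=_)
open ℕSolver.+-*-Solver using () renaming (solve to solveℕ; _:+_ to _⊞_; _:=_ to _⊜_)

Series : Set
Series = ℕ → ℤ

open Setoid (ℕ →-setoid ℤ) public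
  using () renaming (refl to ≗-refl; sym to ≗-sym; trans to ≗-trans)
module ≗-Reasoning = SetoidReasoning (ℕ →-setoid ℤ)

infix 4 _≈[_]_
_≈[_]_ : Series → ℕ → Series → Set
a ≈[ N ] b = ∀ n → n ≤ N → a n ≡ b n

≈-refl : ∀ {a N} → a ≈[ N ] a
≈-refl n _ = refl

≈-sym : ∀ {a b N} → a ≈[ N ] b → b ≈[ N ] a
≈-sym p n h = sym (p n h)

≈-trans : ∀ {a b c N} → a ≈[ N ] b → b ≈[ N ] c → a ≈[ N ] c
≈-trans p q n h = trans (p n h) (q n h)

agreement-setoid : ℕ → Setoid _ _
agreement-setoid N = record
  { Carrier       = Series
  ; _≈_           = _≈[ N ]_
  ; isEquivalence = record { refl = ≈-refl ; sym = ≈-sym ; trans = ≈-trans }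
  }

module ≈-Reasoning (N : ℕ) = SetoidReasoning (agreement-setoid N)

≗⇒≈ : ∀ {a b N} → a ≗ b → a ≈[ N ] b
≗⇒≈ p n _ = p n

≈⇒≗ : ∀ {a b} → (∀ N → a ≈[ N ] b) → a ≗ b
≈⇒≗ p n = p n n ℕₚ.≤-refl

infixl 6 _⊕_
infixr 7 ⊝_
infixr 7 q^_·_

_⊕_ : Series → Series → Series
(a ⊕ b) n = a n +ℤ b n

⊝_ : Series → Series
(⊝ a) n = - a n

0ₛ : Series
0ₛ _ = 0ℤ

1ₛ : Series
1ₛ zero    = 1ℤ
1ₛ (suc _) = 0ℤ

q^_·_ : ℕ → Series → Series
(q^ zero  · a) n       = a n
(q^ suc k · a) zero    = 0ℤ
(q^ suc k · a) (suc n) = (q^ k · a) n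

⊕-cong : ∀ {a b c d} → a ≗ b → c ≗ d → a ⊕ c ≗ b ⊕ d
⊕-cong p q n = cong₂ _+ℤ_ (p n) (q n)

⊕-congˡ : ∀ a {c d} → c ≗ d → a ⊕ c ≗ a ⊕ d
⊕-congˡ a = ⊕-cong {a} ≗-refl

⊕-congʳ : ∀ {a b} c → a ≗ b → a ⊕ c ≗ b ⊕ c
⊕-congʳ c p = ⊕-cong p (≗-refl {c})

⊕-≈ : ∀ {a b c d N} → a ≈[ N ] b → c ≈[ N ] d → a ⊕ c ≈[ N ] b ⊕ d
⊕-≈ p q n h = cong₂ _+ℤ_ (p n h) (q n h)

⊝-cong : ∀ {a b} → a ≗ b → ⊝ a ≗ ⊝ b
⊝-cong p n = cong -_ (p n)

⊕-assoc : ∀ a b c → a ⊕ b ⊕ c ≗ a ⊕ (b ⊕ c)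
⊕-assoc a b c n = ℤₚ.+-assoc (a n) (b n) (c n)

⊕-identityʳ : ∀ a → a ⊕ 0ₛ ≗ a
⊕-identityʳ a n = ℤₚ.+-identityʳ (a n)

⊕-interchange : ∀ a b c d → (a ⊕ b) ⊕ (c ⊕ d) ≗ (a ⊕ c) ⊕ (b ⊕ d)
⊕-interchange a b c d n =
  solve 4 (λ x y z w → (x :+ y) :+ (z :+ w) := (x :+ z) :+ (y :+ w)) refl (a n) (b n) (c n) (d n)

⊕-swapʳ : ∀ a b c → a ⊕ b ⊕ c ≗ a ⊕ c ⊕ b
⊕-swapʳ a b c n = solve 3 (λ x y z → (x :+ y) :+ z := (x :+ z) :+ y) refl (a n) (b n) (c n)

⊝-distrib-⊕ : ∀ a b → ⊝ (a ⊕ b) ≗ ⊝ a ⊕ ⊝ b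
⊝-distrib-⊕ a b n = ℤₚ.neg-distrib-+ (a n) (b n)

shift-cong : ∀ k {a b} → a ≗ b → q^ k · a ≗ q^ k · b
shift-cong zero    p         = p
shift-cong (suc k) p zero    = refl
shift-cong (suc k) p (suc n) = shift-cong k p n

shift-≈ : ∀ k {a b N} → a ≈[ N ] b → q^ k · a ≈[ N ] q^ k · b
shift-≈ zero    p         = p
shift-≈ (suc k) p zero    _ = refl
shift-≈ (suc k) p (suc n) h = shift-≈ k p n (ℕₚ.≤-trans (ℕₚ.n≤1+n n) h)

shift-suc-≈ : ∀ k {a b N} → a ≈[ N ] b → q^ suc k · a ≈[ suc N ] q^ suc k · b
shift-suc-≈ k p zero    _       = refl
shift-suc-≈ k p (suc n) (s≤s h) = shift-≈ k p n h

shift-⊕ : ∀ k a b → q^ k · (a ⊕ b) ≗ q^ k · a ⊕ q^ k · b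
shift-⊕ zero    a b n       = refl
shift-⊕ (suc k) a b zero    = refl
shift-⊕ (suc k) a b (suc n) = shift-⊕ k a b n

shift-⊝ : ∀ k a → q^ k · ⊝ a ≗ ⊝ q^ k · a
shift-⊝ zero    a n       = refl
shift-⊝ (suc k) a zero    = refl
shift-⊝ (suc k) a (suc n) = shift-⊝ k a n

shift-0ₛ : ∀ k → q^ k · 0ₛ ≗ 0ₛ
shift-0ₛ zero    n       = refl
shift-0ₛ (suc k) zero    = refl
shift-0ₛ (suc k) (suc n) = shift-0ₛ k n

shift-shift : ∀ j k a → q^ j · q^ k · a ≗ q^ (j + k) · a
shift-shift zero    k a n       = refl
shift-shift (suc j) k a zero    = refl
shift-shift (suc j) k a (suc n) = shift-shift j k a n

shift-comm : ∀ j k a → q^ j · q^ k · a ≗ q^ k · q^ j · a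
shift-comm j k a n = begin
  (q^ j · q^ k · a) n  ≡⟨ shift-shift j k a n ⟩
  (q^ (j + k) · a) n   ≡⟨ cong (λ i → (q^ i · a) n) (ℕₚ.+-comm j k) ⟩
  (q^ (k + j) · a) n   ≡⟨ shift-shift k j a n ⟨
  (q^ k · q^ j · a) n  ∎
  where open ≡-Reasoning

shift-exponent : ∀ {j k} a → j ≡ k → q^ j · a ≗ q^ k · a
shift-exponent a refl = ≗-refl

shift-below : ∀ k a n → n < k → (q^ k · a) n ≡ 0ℤ
shift-below (suc k) a zero    _       = refl
shift-below (suc k) a (suc n) (s≤s h) = shift-below k a n h

shift-above : ∀ k a n → k ≤ n → (q^ k · a) n ≡ a (n ∸ k)
shift-above zero    a n       _       = refl
shift-above (suc k) a (suc n) (s≤s h) = shift-above k a n h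

shift-≈0ₛ : ∀ k a N → N < k → q^ k · a ≈[ N ] 0ₛ
shift-≈0ₛ k a N h n n≤N = shift-below k a n (ℕₚ.≤-<-trans n≤N h)

shift-1ₛ-diagonal : ∀ e → (q^ e · 1ₛ) e ≡ 1ℤ
shift-1ₛ-diagonal zero    = refl
shift-1ₛ-diagonal (suc e) = shift-1ₛ-diagonal e

shift-1ₛ-off-diagonal : ∀ e n → e ≢ n → (q^ e · 1ₛ) n ≡ 0ℤ
shift-1ₛ-off-diagonal zero    zero    e≢n = ⊥-elim (e≢n refl)
shift-1ₛ-off-diagonal zero    (suc n) _   = refl
shift-1ₛ-off-diagonal (suc e) zero    _   = refl
shift-1ₛ-off-diagonal (suc e) (suc n) e≢n = shift-1ₛ-off-diagonal e n (e≢n ∘ cong suc)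

infixr 7 ⟨1-q^_⟩·_ ⟨1+q^_⟩·_ ⟨1-q^_⟩⁻¹·_

⟨1-q^_⟩·_ : ℕ → Series → Series
⟨1-q^ k ⟩· a = a ⊕ ⊝ q^ k · a

⟨1+q^_⟩·_ : ℕ → Series → Series
⟨1+q^ k ⟩· a = a ⊕ q^ k · a

-- The first `fuel` unfoldings of c = a ⊕ q^(k+1)·c: exact in every degree below `fuel`.
divideFuel : ℕ → ℕ → Series → Series
divideFuel zero     k a n = 0ℤ
divideFuel (suc f)  k a n = a n +ℤ (q^ suc k · divideFuel f k a) n

-- For k = 0 the result is junk (1 - q⁰ = 0); only k ≥ 1 is ever used.
⟨1-q^_⟩⁻¹·_ : ℕ → Series → Series
⟨1-q^ zero  ⟩⁻¹· a = a
⟨1-q^ suc k ⟩⁻¹· a = λ n → divideFuel (suc n) k a n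

divideFuel-stable : ∀ k a f f' n → n < f → n < f' → divideFuel f k a n ≡ divideFuel f' k a n
divideFuel-stable k a (suc f) (suc f') zero    _       _        = refl
divideFuel-stable k a (suc f) (suc f') (suc n) (s≤s h) (s≤s h') =
  cong (a (suc n) +ℤ_) (shift-suc-≈ k stable (suc n) ℕₚ.≤-refl)
  where
  stable : divideFuel f k a ≈[ n ] divideFuel f' k a
  stable m m≤n = divideFuel-stable k a f f' m (ℕₚ.<-≤-trans (s≤s m≤n) h) (ℕₚ.<-≤-trans (s≤s m≤n) h')

⁻¹·-unfold : ∀ k a → ⟨1-q^ suc k ⟩⁻¹· a ≗ a ⊕ q^ suc k · ⟨1-q^ suc k ⟩⁻¹· a
⁻¹·-unfold k a zero    = refl
⁻¹·-unfold k a (suc n) = cong (a (suc n) +ℤ_) (shift-suc-≈ k stable (suc n) ℕₚ.≤-refl)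
  where
  stable : divideFuel (suc n) k a ≈[ n ] ⟨1-q^ suc k ⟩⁻¹· a
  stable m m≤n = divideFuel-stable k a (suc n) (suc m) m (s≤s m≤n) ℕₚ.≤-refl

≈-pred : ∀ {a b N} → a ≈[ suc N ] b → a ≈[ N ] b
≈-pred p n h = p n (ℕₚ.m≤n⇒m≤1+n h)

fixpoint-unique : ∀ k {a b x y} N → x ≈[ N ] a ⊕ q^ suc k · x → y ≈[ N ] b ⊕ q^ suc k · y →
                  a ≈[ N ] b → x ≈[ N ] y
fixpoint-unique k zero px py pab =
  ≈-trans px (≈-trans (⊕-≈ pab λ { zero _ → refl }) (≈-sym py))
fixpoint-unique k {x = x} {y} (suc N) px py pab =
  ≈-trans px (≈-trans (⊕-≈ pab (shift-suc-≈ k below)) (≈-sym py))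
  where
  below : x ≈[ N ] y
  below = fixpoint-unique k N (≈-pred px) (≈-pred py) (≈-pred pab)

fixpoint-unique-≗ : ∀ k {a x y} → x ≗ a ⊕ q^ suc k · x → y ≗ a ⊕ q^ suc k · y → x ≗ y
fixpoint-unique-≗ k {a} px py = ≈⇒≗ λ N → fixpoint-unique k {a} {a} N (≗⇒≈ px) (≗⇒≈ py) ≈-refl

⁻¹·-≈ : ∀ k {a b N} → a ≈[ N ] b → ⟨1-q^ k ⟩⁻¹· a ≈[ N ] ⟨1-q^ k ⟩⁻¹· b
⁻¹·-≈ zero    p = p
⁻¹·-≈ (suc k) {a} {b} {N} p = fixpoint-unique k N (≗⇒≈ (⁻¹·-unfold k a)) (≗⇒≈ (⁻¹·-unfold k b)) p

⟨1-q^⟩·a⊕q^·a≗a : ∀ k a → ⟨1-q^ k ⟩· a ⊕ q^ k · a ≗ a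
⟨1-q^⟩·a⊕q^·a≗a k a n = solve 2 (λ x y → (x :+ (:- y)) :+ y := x) refl (a n) ((q^ k · a) n)

⟨1-q^⟩·-inverseʳ : ∀ k a → ⟨1-q^ suc k ⟩· ⟨1-q^ suc k ⟩⁻¹· a ≗ a
⟨1-q^⟩·-inverseʳ k a n rewrite ⁻¹·-unfold k a n =
  solve 2 (λ x y → (x :+ y) :+ (:- y) := x) refl (a n) ((q^ suc k · ⟨1-q^ suc k ⟩⁻¹· a) n)

⟨1-q^⟩·-inverseˡ : ∀ k a → ⟨1-q^ suc k ⟩⁻¹· ⟨1-q^ suc k ⟩· a ≗ a
⟨1-q^⟩·-inverseˡ k a =
  fixpoint-unique-≗ k {⟨1-q^ suc k ⟩· a} (⁻¹·-unfold k (⟨1-q^ suc k ⟩· a)) (≗-sym (⟨1-q^⟩·a⊕q^·a≗a (suc k) a))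

⊕-≈0ₛ : ∀ {a b N} → b ≈[ N ] 0ₛ → a ⊕ b ≈[ N ] a
⊕-≈0ₛ {a} p n h = trans (cong (a n +ℤ_) (p n h)) (ℤₚ.+-identityʳ (a n))

⟨1-q^⟩·-≈-id : ∀ k a N → N < k → ⟨1-q^ k ⟩· a ≈[ N ] a
⟨1-q^⟩·-≈-id k a N h = ⊕-≈0ₛ λ n n≤N → cong -_ (shift-≈0ₛ k a N h n n≤N)

⟨1+q^⟩·-≈-id : ∀ k a N → N < k → ⟨1+q^ k ⟩· a ≈[ N ] a
⟨1+q^⟩·-≈-id k a N h = ⊕-≈0ₛ (shift-≈0ₛ k a N h)

⁻¹·-≈-id : ∀ k a N → N < k → ⟨1-q^ k ⟩⁻¹· a ≈[ N ] a
⁻¹·-≈-id zero    a N h = ≈-refl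
⁻¹·-≈-id (suc k) a N h = ≈-trans (≗⇒≈ (⁻¹·-unfold k a)) (⊕-≈0ₛ (shift-≈0ₛ (suc k) _ N h))

-- Operators of this kind are exactly the multiplications by a fixed power series.
record IsMultiplier (L : Series → Series) : Set where
  field
    preserves-≈ : ∀ {a b N} → a ≈[ N ] b → L a ≈[ N ] L b
    ⊕-homo      : ∀ a b → L (a ⊕ b) ≗ L a ⊕ L b
    shift-homo  : ∀ k a → L (q^ k · a) ≗ q^ k · L a

  preserves-≗ : ∀ {a b} → a ≗ b → L a ≗ L b
  preserves-≗ p = ≈⇒≗ λ _ → preserves-≈ (≗⇒≈ p)

  0ₛ-homo : L 0ₛ ≗ 0ₛ
  0ₛ-homo n = x≡x+x⇒x≡0 (trans (preserves-≗ (λ _ → refl) n) (⊕-homo 0ₛ 0ₛ n))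
    where
    x≡x+x⇒x≡0 : ∀ {x} → x ≡ x +ℤ x → x ≡ 0ℤ
    x≡x+x⇒x≡0 {x} h = begin
      x                 ≡⟨ solve 1 (λ y → y := (y :+ y) :+ (:- y)) refl x ⟩
      (x +ℤ x) +ℤ - x   ≡⟨ cong (_+ℤ - x) h ⟨
      x +ℤ - x          ≡⟨ ℤₚ.+-inverseʳ x ⟩
      0ℤ                ∎
      where open ≡-Reasoning

  ⊝-homo : ∀ a → L (⊝ a) ≗ ⊝ L a
  ⊝-homo a n = begin
    L (⊝ a) n
      ≡⟨ solve 2 (λ x y → x := (x :+ y) :+ (:- y)) refl (L (⊝ a) n) (L a n) ⟩
    (L (⊝ a) n +ℤ L a n) +ℤ - L a n
      ≡⟨ cong (_+ℤ - L a n) (⊕-homo (⊝ a) a n) ⟨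
    L (⊝ a ⊕ a) n +ℤ - L a n
      ≡⟨ cong (_+ℤ - L a n) (trans (preserves-≗ ⊝a⊕a≗0 n) (0ₛ-homo n)) ⟩
    0ℤ +ℤ - L a n
      ≡⟨ ℤₚ.+-identityˡ (- L a n) ⟩
    - L a n ∎
    where
    open ≡-Reasoning
    ⊝a⊕a≗0 : ⊝ a ⊕ a ≗ 0ₛ
    ⊝a⊕a≗0 n = ℤₚ.+-inverseˡ (a n)

open IsMultiplier public

id-multiplier : IsMultiplier (λ a → a)
id-multiplier = record { preserves-≈ = λ p → p ; ⊕-homo = λ _ _ → ≗-refl ; shift-homo = λ _ _ → ≗-refl }

0ₛ-multiplier : IsMultiplier (λ _ → 0ₛ)
0ₛ-multiplier = record
  { preserves-≈ = λ _ → ≈-refl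
  ; ⊕-homo      = λ _ _ _ → refl
  ; shift-homo  = λ k _ → ≗-sym (shift-0ₛ k)
  }

∘-multiplier : ∀ {L M} → IsMultiplier L → IsMultiplier M → IsMultiplier (λ a → L (M a))
∘-multiplier ML MM = record
  { preserves-≈ = λ p → preserves-≈ ML (preserves-≈ MM p)
  ; ⊕-homo      = λ a b → ≗-trans (preserves-≗ ML (⊕-homo MM a b)) (⊕-homo ML _ _)
  ; shift-homo  = λ k a → ≗-trans (preserves-≗ ML (shift-homo MM k a)) (shift-homo ML k _)
  }

⊕-multiplier : ∀ {L M} → IsMultiplier L → IsMultiplier M → IsMultiplier (λ a → L a ⊕ M a)
⊕-multiplier {L} {M} ML MM = record
  { preserves-≈ = λ p → ⊕-≈ (preserves-≈ ML p) (preserves-≈ MM p)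
  ; ⊕-homo      = λ a b → ≗-trans (⊕-cong (⊕-homo ML a b) (⊕-homo MM a b)) (⊕-interchange (L a) (L b) (M a) (M b))
  ; shift-homo  = λ k a → ≗-trans (⊕-cong (shift-homo ML k a) (shift-homo MM k a)) (≗-sym (shift-⊕ k (L a) (M a)))
  }

⊝-multiplier : ∀ {L} → IsMultiplier L → IsMultiplier (λ a → ⊝ L a)
⊝-multiplier {L} ML = record
  { preserves-≈ = λ p n h → cong -_ (preserves-≈ ML p n h)
  ; ⊕-homo      = λ a b → ≗-trans (⊝-cong (⊕-homo ML a b)) (⊝-distrib-⊕ (L a) (L b))
  ; shift-homo  = λ k a → ≗-trans (⊝-cong (shift-homo ML k a)) (≗-sym (shift-⊝ k (L a)))
  }

shift-multiplier : ∀ j → IsMultiplier (q^ j ·_)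
shift-multiplier j = record { preserves-≈ = shift-≈ j ; ⊕-homo = shift-⊕ j ; shift-homo = λ k a → shift-comm j k a }

⟨1-q^⟩·-multiplier : ∀ k → IsMultiplier (⟨1-q^ k ⟩·_)
⟨1-q^⟩·-multiplier k = ⊕-multiplier id-multiplier (⊝-multiplier (shift-multiplier k))

⟨1+q^⟩·-multiplier : ∀ k → IsMultiplier (⟨1+q^ k ⟩·_)
⟨1+q^⟩·-multiplier k = ⊕-multiplier id-multiplier (shift-multiplier k)

⁻¹·-multiplier : ∀ k → IsMultiplier (⟨1-q^ k ⟩⁻¹·_)
⁻¹·-multiplier zero    = id-multiplier
⁻¹·-multiplier (suc k) = record
  { preserves-≈ = ⁻¹·-≈ (suc k)
  ; ⊕-homo      = λ a b → ≗-sym (fixpoint-unique-≗ k {a ⊕ b} (sum-unfolds a b) (⁻¹·-unfold k (a ⊕ b)))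
  ; shift-homo  = λ j a → ≗-sym (fixpoint-unique-≗ k {q^ j · a} (shift-unfolds j a) (⁻¹·-unfold k (q^ j · a)))
  }
  where
  D = ⟨1-q^ suc k ⟩⁻¹·_
  sum-unfolds : ∀ a b → D a ⊕ D b ≗ (a ⊕ b) ⊕ q^ suc k · (D a ⊕ D b)
  sum-unfolds a b = ≗-trans (⊕-cong (⁻¹·-unfold k a) (⁻¹·-unfold k b))
    (≗-trans (⊕-interchange a _ b _) (⊕-congˡ (a ⊕ b) (≗-sym (shift-⊕ (suc k) (D a) (D b)))))
  shift-unfolds : ∀ j a → q^ j · D a ≗ q^ j · a ⊕ q^ suc k · q^ j · D a
  shift-unfolds j a = ≗-trans (shift-cong j (⁻¹·-unfold k a))
    (≗-trans (shift-⊕ j a _) (⊕-congˡ (q^ j · a) (shift-comm j (suc k) (D a))))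

Central : (Series → Series) → Set
Central F = ∀ {L} → IsMultiplier L → ∀ a → F (L a) ≗ L (F a)

shift-central : ∀ k → Central (q^ k ·_)
shift-central k ML a = ≗-sym (shift-homo ML k a)

⟨1-q^⟩·-central : ∀ k → Central (⟨1-q^ k ⟩·_)
⟨1-q^⟩·-central k {L} ML a = ≗-sym (≗-trans (⊕-homo ML a _)
  (⊕-congˡ (L a) (≗-trans (⊝-homo ML (q^ k · a)) (⊝-cong (shift-homo ML k a)))))

⟨1+q^⟩·-central : ∀ k → Central (⟨1+q^ k ⟩·_)
⟨1+q^⟩·-central k {L} ML a = ≗-sym (≗-trans (⊕-homo ML a _) (⊕-congˡ (L a) (shift-homo ML k a)))

⁻¹·-central : ∀ k → Central (⟨1-q^ k ⟩⁻¹·_)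
⁻¹·-central zero    ML a = ≗-refl
⁻¹·-central (suc k) {L} ML a =
  fixpoint-unique-≗ k {L a} (⁻¹·-unfold k (L a)) L-unfolds
  where
  L-unfolds : L (⟨1-q^ suc k ⟩⁻¹· a) ≗ L a ⊕ q^ suc k · L (⟨1-q^ suc k ⟩⁻¹· a)
  L-unfolds = ≗-trans (preserves-≗ ML (⁻¹·-unfold k a))
    (≗-trans (⊕-homo ML a _) (⊕-congˡ (L a) (shift-homo ML (suc k) _)))

0ₛ-central : Central (λ _ → 0ₛ)
0ₛ-central ML a = ≗-sym (0ₛ-homo ML)

∏ : (ℕ → Series → Series) → ℕ → Series → Series
∏ f zero    a = a
∏ f (suc m) a = f (suc m) (∏ f m a)

∏-multiplier : ∀ {f} → (∀ k → IsMultiplier (f k)) → ∀ m → IsMultiplier (∏ f m)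
∏-multiplier Mf zero    = id-multiplier
∏-multiplier Mf (suc m) = ∘-multiplier (Mf (suc m)) (∏-multiplier Mf m)

∏-central : ∀ {f} → (∀ k → IsMultiplier (f k)) → (∀ k → Central (f k)) → ∀ m → Central (∏ f m)
∏-central Mf Cf zero    ML a = ≗-refl
∏-central Mf Cf (suc m) ML a = ≗-trans (preserves-≗ (Mf (suc m)) (∏-central Mf Cf m ML a)) (Cf (suc m) ML _)

∏-≈-truncate : ∀ {f} → (∀ k a N → N < k → f k a ≈[ N ] a) → ∀ m N a → N ≤ m → ∏ f m a ≈[ N ] ∏ f N a
∏-≈-truncate {f} trivial m N a N≤m
  rewrite sym (ℕₚ.m∸n+n≡m N≤m) = go (m ∸ N)
  where
  go : ∀ d → ∏ f (d + N) a ≈[ N ] ∏ f N a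
  go zero    = ≈-refl
  go (suc d) = ≈-trans (trivial (suc (d + N)) _ N (s≤s (ℕₚ.m≤n+m N d))) (go d)

infix 5 ∑
∑ : ℕ → (ℕ → Series) → Series
∑ zero    F = F 0
∑ (suc m) F = ∑ m F ⊕ F (suc m)

syntax ∑ m (λ a → F) = ∑[ a ≤ m ] F

∑-cong : ∀ m {F G} → (∀ a → a ≤ m → F a ≗ G a) → ∑ m F ≗ ∑ m G
∑-cong zero    p = p 0 z≤n
∑-cong (suc m) p = ⊕-cong (∑-cong m λ a h → p a (ℕₚ.m≤n⇒m≤1+n h)) (p (suc m) ℕₚ.≤-refl)

∑-≈ : ∀ m {F G N} → (∀ a → a ≤ m → F a ≈[ N ] G a) → ∑ m F ≈[ N ] ∑ m G
∑-≈ zero    p = p 0 z≤n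
∑-≈ (suc m) p = ⊕-≈ (∑-≈ m λ a h → p a (ℕₚ.m≤n⇒m≤1+n h)) (p (suc m) ℕₚ.≤-refl)

∑-⊕ : ∀ m F G → (∑[ a ≤ m ] (F a ⊕ G a)) ≗ ∑ m F ⊕ ∑ m G
∑-⊕ zero    F G = ≗-refl
∑-⊕ (suc m) F G = ≗-trans (⊕-congʳ (F (suc m) ⊕ G (suc m)) (∑-⊕ m F G))
                          (⊕-interchange (∑ m F) (∑ m G) (F (suc m)) (G (suc m)))

multiplier-∑ : ∀ {L} → IsMultiplier L → ∀ m F → L (∑ m F) ≗ (∑[ a ≤ m ] L (F a))
multiplier-∑ ML zero    F = ≗-refl
multiplier-∑ ML (suc m) F = ≗-trans (⊕-homo ML (∑ m F) (F (suc m))) (⊕-congʳ _ (multiplier-∑ ML m F))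

∑-suc : ∀ m F → ∑ (suc m) F ≗ F 0 ⊕ (∑[ a ≤ m ] F (suc a))
∑-suc zero    F = ≗-refl
∑-suc (suc m) F = ≗-trans (⊕-congʳ (F (suc (suc m))) (∑-suc m F)) (⊕-assoc (F 0) _ (F (suc (suc m))))

∑-reverse : ∀ m F → ∑ m F ≗ (∑[ a ≤ m ] F (m ∸ a))
∑-reverse zero    F = ≗-refl
∑-reverse (suc m) F n = begin
  ∑ m F n +ℤ F (suc m) n                          ≡⟨ cong (_+ℤ F (suc m) n) (∑-reverse m F n) ⟩
  (∑[ a ≤ m ] F (m ∸ a)) n +ℤ F (suc m) n         ≡⟨ ℤₚ.+-comm _ (F (suc m) n) ⟩
  F (suc m) n +ℤ (∑[ a ≤ m ] F (m ∸ a)) n         ≡⟨ ∑-suc m (λ a → F (suc m ∸ a)) n ⟨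
  (∑[ a ≤ suc m ] F (suc m ∸ a)) n                ∎
  where open ≡-Reasoning

∑-coefficient-0 : ∀ m F n → (∀ a → a ≤ m → F a n ≡ 0ℤ) → ∑ m F n ≡ 0ℤ
∑-coefficient-0 zero    F n F≡0 = F≡0 0 z≤n
∑-coefficient-0 (suc m) F n F≡0 =
  cong₂ _+ℤ_ (∑-coefficient-0 m F n λ a a≤m → F≡0 a (ℕₚ.m≤n⇒m≤1+n a≤m)) (F≡0 (suc m) ℕₚ.≤-refl)

∑-coefficient-single : ∀ m F n a₀ → a₀ ≤ m → (∀ a → a ≤ m → a ≢ a₀ → F a n ≡ 0ℤ) → ∑ m F n ≡ F a₀ n
∑-coefficient-single zero    F n zero    _   _ = refl
∑-coefficient-single (suc m) F n a₀ a₀≤1+m F≡0 with a₀ ℕₚ.≟ suc m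
... | yes refl = trans (cong (_+ℤ F (suc m) n) (∑-coefficient-0 m F n λ a a≤m →
                   F≡0 a (ℕₚ.m≤n⇒m≤1+n a≤m) (ℕₚ.<⇒≢ (s≤s a≤m)))) (ℤₚ.+-identityˡ _)
... | no a₀≢1+m = trans (cong₂ _+ℤ_ (∑-coefficient-single m F n a₀ (ℕₚ.≤-pred (ℕₚ.≤∧≢⇒< a₀≤1+m a₀≢1+m))
                                        λ a a≤m → F≡0 a (ℕₚ.m≤n⇒m≤1+n a≤m))
                                     (F≡0 (suc m) ℕₚ.≤-refl (a₀≢1+m ∘ sym)))
                        (ℤₚ.+-identityʳ _)

-- Multiplication by (q;q)ₘ, 1/(q;q)ₘ and (-q;q)ₘ respectively.
poch : ℕ → Series → Series
poch = ∏ ⟨1-q^_⟩·_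

poch⁻¹ : ℕ → Series → Series
poch⁻¹ = ∏ ⟨1-q^_⟩⁻¹·_

negPoch : ℕ → Series → Series
negPoch = ∏ ⟨1+q^_⟩·_

poch-multiplier : ∀ m → IsMultiplier (poch m)
poch-multiplier = ∏-multiplier ⟨1-q^⟩·-multiplier

poch⁻¹-multiplier : ∀ m → IsMultiplier (poch⁻¹ m)
poch⁻¹-multiplier = ∏-multiplier ⁻¹·-multiplier

negPoch-multiplier : ∀ m → IsMultiplier (negPoch m)
negPoch-multiplier = ∏-multiplier ⟨1+q^⟩·-multiplier

poch-central : ∀ m → Central (poch m)
poch-central = ∏-central ⟨1-q^⟩·-multiplier ⟨1-q^⟩·-central

poch⁻¹-central : ∀ m → Central (poch⁻¹ m)
poch⁻¹-central = ∏-central ⁻¹·-multiplier ⁻¹·-central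

negPoch-central : ∀ m → Central (negPoch m)
negPoch-central = ∏-central ⟨1+q^⟩·-multiplier ⟨1+q^⟩·-central

poch-≈-truncate : ∀ m N a → N ≤ m → poch m a ≈[ N ] poch N a
poch-≈-truncate = ∏-≈-truncate ⟨1-q^⟩·-≈-id

poch⁻¹-≈-truncate : ∀ m N a → N ≤ m → poch⁻¹ m a ≈[ N ] poch⁻¹ N a
poch⁻¹-≈-truncate = ∏-≈-truncate ⁻¹·-≈-id

negPoch-≈-truncate : ∀ m N a → N ≤ m → negPoch m a ≈[ N ] negPoch N a
negPoch-≈-truncate = ∏-≈-truncate ⟨1+q^⟩·-≈-id

poch-poch⁻¹ : ∀ m a → poch m (poch⁻¹ m a) ≗ a
poch-poch⁻¹ zero    a = ≗-refl
poch-poch⁻¹ (suc m) a = begin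
  ⟨1-q^ suc m ⟩· poch m (⟨1-q^ suc m ⟩⁻¹· poch⁻¹ m a)
    ≈⟨ preserves-≗ (⟨1-q^⟩·-multiplier (suc m)) (poch-central m (⁻¹·-multiplier (suc m)) _) ⟩
  ⟨1-q^ suc m ⟩· ⟨1-q^ suc m ⟩⁻¹· poch m (poch⁻¹ m a)
    ≈⟨ ⟨1-q^⟩·-inverseʳ m _ ⟩
  poch m (poch⁻¹ m a)
    ≈⟨ poch-poch⁻¹ m a ⟩
  a ∎
  where open ≗-Reasoning

poch⁻¹-unfold : ∀ m a → poch⁻¹ m a ≗ ⟨1-q^ suc m ⟩· poch⁻¹ (suc m) a
poch⁻¹-unfold m a = ≗-sym (⟨1-q^⟩·-inverseʳ m (poch⁻¹ m a))

qbinom : ℕ → ℕ → Series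
qbinom m i with i ≤? m
... | yes _ = poch m (poch⁻¹ i (poch⁻¹ (m ∸ i) 1ₛ))
... | no  _ = 0ₛ

qbinom-≤ : ∀ {m i} → i ≤ m → qbinom m i ≗ poch m (poch⁻¹ i (poch⁻¹ (m ∸ i) 1ₛ))
qbinom-≤ {m} {i} i≤m with i ≤? m
... | yes _   = ≗-refl
... | no  i≰m = contradiction i≤m i≰m

qbinom-> : ∀ {m i} → m < i → qbinom m i ≗ 0ₛ
qbinom-> {m} {i} m<i with i ≤? m
... | yes i≤m = contradiction i≤m (ℕₚ.<⇒≱ m<i)
... | no  _   = ≗-refl

qbinom-0 : ∀ m → qbinom m 0 ≗ 1ₛ
qbinom-0 m = ≗-trans (qbinom-≤ {m} z≤n) (poch-poch⁻¹ m 1ₛ)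

qbinom-diag : ∀ m → qbinom m m ≗ 1ₛ
qbinom-diag m = ≗-trans (qbinom-≤ {m} ℕₚ.≤-refl) λ n →
  trans (cong (λ j → poch m (poch⁻¹ m (poch⁻¹ j 1ₛ)) n) (ℕₚ.n∸n≡0 m)) (poch-poch⁻¹ m 1ₛ n)

qbinom-symmetric : ∀ m a → a ≤ m → qbinom m (m ∸ a) ≗ qbinom m a
qbinom-symmetric m a a≤m = begin
  qbinom m (m ∸ a)
    ≈⟨ qbinom-≤ {m} (ℕₚ.m∸n≤m m a) ⟩
  poch m (poch⁻¹ (m ∸ a) (poch⁻¹ (m ∸ (m ∸ a)) 1ₛ))
    ≈⟨ (λ n → cong (λ j → poch m (poch⁻¹ (m ∸ a) (poch⁻¹ j 1ₛ)) n) (ℕₚ.m∸[m∸n]≡n a≤m)) ⟩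
  poch m (poch⁻¹ (m ∸ a) (poch⁻¹ a 1ₛ))
    ≈⟨ preserves-≗ (poch-multiplier m) (poch⁻¹-central (m ∸ a) (poch⁻¹-multiplier a) 1ₛ) ⟩
  poch m (poch⁻¹ a (poch⁻¹ (m ∸ a) 1ₛ))
    ≈⟨ qbinom-≤ {m} a≤m ⟨
  qbinom m a ∎
  where open ≗-Reasoning

⟨1-q^+⟩·-split : ∀ j k a → ⟨1-q^ (j + k) ⟩· a ≗ ⟨1-q^ j ⟩· a ⊕ q^ j · ⟨1-q^ k ⟩· a
⟨1-q^+⟩·-split j k a n = begin
  a n +ℤ - (q^ (j + k) · a) n
    ≡⟨ cong (λ x → a n +ℤ - x) (shift-shift j k a n) ⟨
  a n +ℤ - y
    ≡⟨ solve 3 (λ w x y → w :+ (:- y) := (w :+ (:- x)) :+ (x :+ (:- y))) refl (a n) x y ⟩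
  (a n +ℤ - x) +ℤ (x +ℤ - y)
    ≡⟨ cong (λ z → (a n +ℤ - x) +ℤ (x +ℤ z)) (shift-⊝ j (q^ k · a) n) ⟨
  (a n +ℤ - x) +ℤ (x +ℤ (q^ j · ⊝ q^ k · a) n)
    ≡⟨ cong ((a n +ℤ - x) +ℤ_) (shift-⊕ j a (⊝ q^ k · a) n) ⟨
  (a n +ℤ - x) +ℤ (q^ j · (a ⊕ ⊝ q^ k · a)) n ∎
  where
  open ≡-Reasoning
  x = (q^ j · a) n
  y = (q^ j · q^ k · a) n

qbinom-≤-≡ : ∀ {m i j} → i ≤ m → m ∸ i ≡ j → qbinom m i ≗ poch m (poch⁻¹ i (poch⁻¹ j 1ₛ))
qbinom-≤-≡ i≤m refl = qbinom-≤ i≤m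

⟨1-q^⟩·-exponent : ∀ {j k} a → j ≡ k → ⟨1-q^ j ⟩· a ≗ ⟨1-q^ k ⟩· a
⟨1-q^⟩·-exponent a refl = ≗-refl

1+a+c∸a≡1+c : ∀ a c → suc (a + c) ∸ a ≡ suc c
1+a+c∸a≡1+c a c = trans (cong (_∸ a) (sym (ℕₚ.+-suc a c))) (ℕₚ.m+n∸m≡n a (suc c))

qbinom-pascal-interior : ∀ a c → let m = suc (a + c) in
                         qbinom (suc m) (suc a) ≗ qbinom m (suc a) ⊕ q^ suc c · qbinom m a
qbinom-pascal-interior a c = begin
  qbinom (suc m) (suc a)                            ≈⟨ qbinom-≤-≡ (s≤s (ℕₚ.m≤n⇒m≤1+n (ℕₚ.m≤m+n a c))) (1+a+c∸a≡1+c a c) ⟩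
  ⟨1-q^ suc m ⟩· W                                  ≈⟨ ⟨1-q^⟩·-exponent W (sym exponent) ⟩
  ⟨1-q^ (suc c + suc a) ⟩· W                        ≈⟨ ⟨1-q^+⟩·-split (suc c) (suc a) W ⟩
  ⟨1-q^ suc c ⟩· W ⊕ q^ suc c · ⟨1-q^ suc a ⟩· W    ≈⟨ ⊕-cong left (shift-cong (suc c) right) ⟨
  qbinom m (suc a) ⊕ q^ suc c · qbinom m a          ∎
  where
  open ≗-Reasoning
  m = suc (a + c)
  exponent : suc c + suc a ≡ suc m
  exponent = trans (ℕₚ.+-comm (suc c) (suc a)) (cong suc (ℕₚ.+-suc a c))
  W = poch m (poch⁻¹ (suc a) (poch⁻¹ (suc c) 1ₛ))
  left : qbinom m (suc a) ≗ ⟨1-q^ suc c ⟩· W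
  left = begin
    qbinom m (suc a)
      ≈⟨ qbinom-≤-≡ (s≤s (ℕₚ.m≤m+n a c)) (ℕₚ.m+n∸m≡n a c) ⟩
    poch m (poch⁻¹ (suc a) (poch⁻¹ c 1ₛ))
      ≈⟨ preserves-≗ (poch-multiplier m) (preserves-≗ (poch⁻¹-multiplier (suc a)) (poch⁻¹-unfold c 1ₛ)) ⟩
    poch m (poch⁻¹ (suc a) (⟨1-q^ suc c ⟩· poch⁻¹ (suc c) 1ₛ))
      ≈⟨ preserves-≗ (poch-multiplier m) (poch⁻¹-central (suc a) (⟨1-q^⟩·-multiplier (suc c)) _) ⟩
    poch m (⟨1-q^ suc c ⟩· poch⁻¹ (suc a) (poch⁻¹ (suc c) 1ₛ))
      ≈⟨ poch-central m (⟨1-q^⟩·-multiplier (suc c)) _ ⟩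
    ⟨1-q^ suc c ⟩· W ∎
  right : qbinom m a ≗ ⟨1-q^ suc a ⟩· W
  right = begin
    qbinom m a
      ≈⟨ qbinom-≤-≡ (ℕₚ.m≤n⇒m≤1+n (ℕₚ.m≤m+n a c)) (1+a+c∸a≡1+c a c) ⟩
    poch m (poch⁻¹ a (poch⁻¹ (suc c) 1ₛ))
      ≈⟨ preserves-≗ (poch-multiplier m) (poch⁻¹-unfold a _) ⟩
    poch m (⟨1-q^ suc a ⟩· poch⁻¹ (suc a) (poch⁻¹ (suc c) 1ₛ))
      ≈⟨ poch-central m (⟨1-q^⟩·-multiplier (suc a)) _ ⟩
    ⟨1-q^ suc a ⟩· W ∎

qbinom-pascal : ∀ m a → a ≤ m → qbinom (suc m) (suc a) ≗ qbinom m (suc a) ⊕ q^ (m ∸ a) · qbinom m a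
qbinom-pascal m a a≤m with ℕₚ.m≤n⇒m<n∨m≡n a≤m
... | inj₂ refl = begin
  qbinom (suc a) (suc a)                        ≈⟨ qbinom-diag (suc a) ⟩
  1ₛ                                            ≈⟨ qbinom-diag a ⟨
  qbinom a a                                    ≈⟨ (λ n → sym (ℤₚ.+-identityˡ _)) ⟩
  0ₛ ⊕ qbinom a a                               ≈⟨ ⊕-cong (≗-sym (qbinom-> {a} ℕₚ.≤-refl)) (shift-exponent _ (sym (ℕₚ.n∸n≡0 a))) ⟩
  qbinom a (suc a) ⊕ q^ (a ∸ a) · qbinom a a    ∎
  where open ≗-Reasoning
... | inj₁ a<m with ℕₚ.m≤n⇒∃[o]m+o≡n a<m
... | c , refl =
  ≗-trans (qbinom-pascal-interior a c) (⊕-congˡ (qbinom m (suc a)) (shift-exponent (qbinom m a) (sym (1+a+c∸a≡1+c a c))))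

qbinom-≈-limit : ∀ m a N → a ≤ m → N ≤ a → N ≤ m ∸ a → qbinom m a ≈[ N ] poch⁻¹ N 1ₛ
qbinom-≈-limit m a N a≤m N≤a N≤m∸a = begin
  qbinom m a
    ≈⟨ ≗⇒≈ (qbinom-≤ a≤m) ⟩
  poch m (poch⁻¹ a (poch⁻¹ (m ∸ a) 1ₛ))
    ≈⟨ poch-≈-truncate m N _ (ℕₚ.≤-trans N≤a a≤m) ⟩
  poch N (poch⁻¹ a (poch⁻¹ (m ∸ a) 1ₛ))
    ≈⟨ preserves-≈ (poch-multiplier N) (poch⁻¹-≈-truncate a N _ N≤a) ⟩
  poch N (poch⁻¹ N (poch⁻¹ (m ∸ a) 1ₛ))
    ≈⟨ preserves-≈ (poch-multiplier N) (preserves-≈ (poch⁻¹-multiplier N) (poch⁻¹-≈-truncate (m ∸ a) N 1ₛ N≤m∸a)) ⟩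
  poch N (poch⁻¹ N (poch⁻¹ N 1ₛ))
    ≈⟨ ≗⇒≈ (poch-poch⁻¹ N _) ⟩
  poch⁻¹ N 1ₛ ∎
  where open ≈-Reasoning N

tri : ℕ → ℕ
tri zero    = 0
tri (suc n) = suc n + tri n

n≤tri : ∀ n → n ≤ tri n
n≤tri zero    = z≤n
n≤tri (suc n) = ℕₚ.m≤m+n (suc n) (tri n)

tri-<-mono : ∀ {x y} → x < y → tri x < tri y
tri-<-mono {x} {suc y} (s≤s x≤y) with ℕₚ.m≤n⇒m<n∨m≡n x≤y
... | inj₁ x<y  = ℕₚ.<-≤-trans (tri-<-mono x<y) (ℕₚ.m≤n+m (tri y) (suc y))
... | inj₂ refl = s≤s (ℕₚ.m≤n+m (tri x) x)

tri-injective : ∀ {x y} → tri x ≡ tri y → x ≡ y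
tri-injective {x} {y} tx≡ty with ℕₚ.<-cmp x y
... | tri< x<y _ _ = ⊥-elim (ℕₚ.<⇒≢ (tri-<-mono x<y) tx≡ty)
... | tri≈ _ x≡y _ = x≡y
... | tri> _ _ y<x = ⊥-elim (ℕₚ.<⇒≢ (tri-<-mono y<x) (sym tx≡ty))

2*tri : ∀ t → 2 * tri t ≡ t * suc t
2*tri zero    = refl
2*tri (suc t) = begin
  2 * (suc t + tri t)          ≡⟨ ℕₚ.*-distribˡ-+ 2 (suc t) (tri t) ⟩
  2 * suc t + 2 * tri t        ≡⟨ cong (λ x → 2 * suc t + x) (2*tri t) ⟩
  2 * suc t + t * suc t        ≡⟨ ℕₚ.*-distribʳ-+ (suc t) 2 t ⟨
  suc (suc t) * suc t          ≡⟨ ℕₚ.*-comm (suc (suc t)) (suc t) ⟩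
  suc t * suc (suc t)          ∎
  where open ≡-Reasoning

Triangular⇒tri : ∀ {N} → Triangular N → ∃[ t ] tri t ≡ N
Triangular⇒tri {N} (k , 2N≡k[k+1]) = k , ℕₚ.*-cancelˡ-≡ (tri k) N 2 (trans (2*tri k) (sym 2N≡k[k+1]))

tri⇒Triangular : ∀ {N} → ∃[ t ] tri t ≡ N → Triangular N
tri⇒Triangular (t , refl) = t , 2*tri t

-- d(d+1)/2 for an integer d.
triℤ : ℤ → ℕ
triℤ (+ n)     = tri n
triℤ -[1+ n ]  = tri n

triℤ-neg : ∀ d → + triℤ d ≡ + triℤ (- d) +ℤ d
triℤ-neg (+ zero)   = refl
triℤ-neg +[1+ n ]   = trans (ℤₚ.pos-+ (suc n) (tri n)) (ℤₚ.+-comm (+ suc n) (+ tri n))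
triℤ-neg -[1+ n ]   = sym (trans (cong (_+ℤ -[1+ n ]) (ℤₚ.pos-+ (suc n) (tri n)))
  (solve 2 (λ y x → (y :+ x) :+ (:- y) := x) refl (+ suc n) (+ tri n)))

-- T(a - k), the exponent of the a-th term of a Jacobi triple product centred at k.
jacobiExponent : ℕ → ℕ → ℕ
jacobiExponent a k = triℤ (+ a -ℤ + k)

jacobiExponent-shift : ∀ a u k c → a + u ≡ k + c → jacobiExponent u k + a ≡ c + jacobiExponent a c
jacobiExponent-shift a u k c a+u≡k+c = ℤₚ.+-injective (begin
  + (jacobiExponent u k + a)        ≡⟨ ℤₚ.pos-+ (jacobiExponent u k) a ⟩
  + triℤ d +ℤ + a                   ≡⟨ cong (_+ℤ + a) (triℤ-neg d) ⟩
  (+ triℤ (- d) +ℤ d) +ℤ + a        ≡⟨ ℤₚ.+-assoc (+ triℤ (- d)) d (+ a) ⟩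
  + triℤ (- d) +ℤ (d +ℤ + a)        ≡⟨ cong₂ (λ e f → + triℤ e +ℤ f) a-c≡-d d+a≡c ⟩
  + jacobiExponent a c +ℤ + c       ≡⟨ ℤₚ.+-comm (+ jacobiExponent a c) (+ c) ⟩
  + c +ℤ + jacobiExponent a c       ≡⟨ ℤₚ.pos-+ c (jacobiExponent a c) ⟨
  + (c + jacobiExponent a c)        ∎)
  where
  open ≡-Reasoning
  d = + u -ℤ + k
  h : + a +ℤ + u ≡ + k +ℤ + c
  h = trans (sym (ℤₚ.pos-+ a u)) (trans (cong +_ a+u≡k+c) (ℤₚ.pos-+ k c))
  a-c≡-d : - d ≡ + a -ℤ + c
  a-c≡-d = begin
    - d
      ≡⟨ solve 3 (λ x y z → :- (y :- x) := (x :+ z) :- (y :+ z)) refl (+ k) (+ u) (+ c) ⟩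
    (+ k +ℤ + c) -ℤ (+ u +ℤ + c)
      ≡⟨ cong (_-ℤ (+ u +ℤ + c)) h ⟨
    (+ a +ℤ + u) -ℤ (+ u +ℤ + c)
      ≡⟨ solve 3 (λ x y z → (x :+ y) :- (y :+ z) := x :- z) refl (+ a) (+ u) (+ c) ⟩
    + a -ℤ + c ∎
  d+a≡c : d +ℤ + a ≡ + c
  d+a≡c = begin
    d +ℤ + a
      ≡⟨ solve 3 (λ x y z → (y :- x) :+ z := (z :+ y) :- x) refl (+ k) (+ u) (+ a) ⟩
    (+ a +ℤ + u) -ℤ + k
      ≡⟨ cong (_-ℤ + k) h ⟩
    (+ k +ℤ + c) -ℤ + k
      ≡⟨ solve 2 (λ x z → (x :+ z) :- x := z) refl (+ k) (+ c) ⟩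
    + c ∎

jacobiExponent-above : ∀ k x → jacobiExponent (k + x) k ≡ tri x
jacobiExponent-above k x = cong triℤ (begin
  + (k + x) -ℤ + k      ≡⟨ cong (_-ℤ + k) (ℤₚ.pos-+ k x) ⟩
  (+ k +ℤ + x) -ℤ + k   ≡⟨ solve 2 (λ k x → (k :+ x) :- k := x) refl (+ k) (+ x) ⟩
  + x                   ∎)
  where
  open ≡-Reasoning

jacobiExponent-below : ∀ a x → jacobiExponent a (a + suc x) ≡ tri x
jacobiExponent-below a x = cong triℤ (begin
  + a -ℤ + (a + suc x)         ≡⟨ cong (λ z → + a -ℤ z) (ℤₚ.pos-+ a (suc x)) ⟩
  + a -ℤ (+ a +ℤ + suc x)      ≡⟨ solve 2 (λ a y → a :- (a :+ y) := :- y) refl (+ a) (+ suc x) ⟩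
  - + suc x                    ∎)
  where
  open ≡-Reasoning

jacobiExponent-cases : ∀ a k → (∃ λ x → a ≡ k + x × jacobiExponent a k ≡ tri x)
                             ⊎ (∃ λ x → a + suc x ≡ k × jacobiExponent a k ≡ tri x)
jacobiExponent-cases a k with ℕₚ.≤-<-connex k a
... | inj₁ k≤a = inj₁ (a ∸ k , a≡ , trans (cong (λ a → jacobiExponent a k) a≡) (jacobiExponent-above k (a ∸ k)))
  where
  a≡ : a ≡ k + (a ∸ k)
  a≡ = sym (ℕₚ.m+[n∸m]≡n k≤a)
... | inj₂ a<k = inj₂ (k ∸ suc a , k≡ , trans (cong (jacobiExponent a) (sym k≡)) (jacobiExponent-below a (k ∸ suc a)))
  where
  k≡ : a + suc (k ∸ suc a) ≡ k
  k≡ = trans (ℕₚ.+-suc a (k ∸ suc a)) (ℕₚ.m+[n∸m]≡n a<k)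

parity-+-≡0ℙ : ∀ {p q} → p +ℙ q ≡ 0ℙ → p ≡ q
parity-+-≡0ℙ {0ℙ} {0ℙ} _ = refl
parity-+-≡0ℙ {1ℙ} {1ℙ} _ = refl

parity-≡-if-sum-double : ∀ {m n} x → m + n ≡ x + x → parity m ≡ parity n
parity-≡-if-sum-double {m} {n} x m+n≡x+x = parity-+-≡0ℙ (begin
  parity m +ℙ parity n   ≡⟨ +-homo-+ m n ⟨
  parity (m + n)         ≡⟨ cong parity m+n≡x+x ⟩
  parity (x + x)         ≡⟨ +-homo-+ x x ⟩
  parity x +ℙ parity x   ≡⟨ p+p≡0ℙ (parity x) ⟩
  0ℙ                     ∎)
  where open ≡-Reasoning

parity-double : ∀ n → parity (n + n) ≡ 0ℙ
parity-double zero    = refl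
parity-double (suc n) = trans (cong (parity ∘ suc) (ℕₚ.+-suc n n)) (parity-double n)

parity-double+1 : ∀ n → parity (suc (n + n)) ≡ 1ℙ
parity-double+1 zero    = refl
parity-double+1 (suc n) = trans (cong (parity ∘ suc ∘ suc) (ℕₚ.+-suc n n)) (parity-double+1 n)

∣⇒parity≡0ℙ : ∀ {n} → 2 ∣ n → parity n ≡ 0ℙ
∣⇒parity≡0ℙ (divides q refl) = parity-*2 q
  where
  parity-*2 : ∀ q → parity (q * 2) ≡ 0ℙ
  parity-*2 zero    = refl
  parity-*2 (suc q) = parity-*2 q

parity≡0ℙ⇒∣ : ∀ n → parity n ≡ 0ℙ → 2 ∣ n
parity≡0ℙ⇒∣ zero          _ = divides 0 refl
parity≡0ℙ⇒∣ (suc (suc n)) p with parity≡0ℙ⇒∣ n p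
... | divides k n≡k*2 = divides (suc k) (cong (λ x → suc (suc x)) n≡k*2)

parity≡1ℙ⇒∤ : ∀ {n} → parity n ≡ 1ℙ → ¬ 2 ∣ n
parity≡1ℙ⇒∤ odd 2∣n with trans (sym odd) (∣⇒parity≡0ℙ 2∣n)
... | ()

parity-suc-≢ : ∀ t → parity (suc t) ≢ parity t
parity-suc-≢ zero          ()
parity-suc-≢ (suc zero)    ()
parity-suc-≢ (suc (suc t)) = parity-suc-≢ t

parity-suc-flip : ∀ t → parity t ≡ 1ℙ → parity (suc t) ≡ 0ℙ
parity-suc-flip t pt with parity (suc t) in ps
... | 0ℙ = refl
... | 1ℙ = ⊥-elim (parity-suc-≢ t (trans ps (sym pt)))

parity-swap : ∀ a u k c → a + u ≡ k + c → parity (u + k) ≡ parity (a + c)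
parity-swap a u k c a+u≡k+c = parity-≡-if-sum-double {u + k} {a + c} (k + c) (begin
  (u + k) + (a + c)   ≡⟨ solveℕ 4 (λ a u k c → (u ⊞ k) ⊞ (a ⊞ c) ⊜ (a ⊞ u) ⊞ (k ⊞ c)) refl a u k c ⟩
  (a + u) + (k + c)   ≡⟨ cong (_+ (k + c)) a+u≡k+c ⟩
  (k + c) + (k + c)   ∎)
  where open ≡-Reasoning

parity-above : ∀ k x → parity ((k + x) + k) ≡ parity x
parity-above k x = parity-≡-if-sum-double {(k + x) + k} {x} (k + x)
  (solveℕ 2 (λ k x → ((k ⊞ x) ⊞ k) ⊞ x ⊜ (k ⊞ x) ⊞ (k ⊞ x)) refl k x)

parity-below : ∀ a x → parity (a + (a + suc x)) ≡ parity (suc x)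
parity-below a x = parity-≡-if-sum-double {a + (a + suc x)} {suc x} (a + suc x)
  (solveℕ 2 (λ a s → (a ⊞ (a ⊞ s)) ⊞ s ⊜ (a ⊞ s) ⊞ (a ⊞ s)) refl a (suc x))

gate : Parity → ℕ → Series → Series
gate 0ℙ e x = q^ e · x
gate 1ℙ e x = 0ₛ

gate-multiplier : ∀ p e → IsMultiplier (gate p e)
gate-multiplier 0ℙ e = shift-multiplier e
gate-multiplier 1ℙ e = 0ₛ-multiplier

gate-central : ∀ p e → Central (gate p e)
gate-central 0ℙ e = shift-central e
gate-central 1ℙ e = 0ₛ-central

gate-≈ : ∀ p e {x y N} → (e ≤ N → x ≈[ N ] y) → gate p e x ≈[ N ] gate p e y
gate-≈ 1ℙ e     _ = ≈-refl
gate-≈ 0ℙ e {x} {y} {N} h with ℕₚ.≤-<-connex e N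
... | inj₁ e≤N = shift-≈ e (h e≤N)
... | inj₂ N<e = ≈-trans (shift-≈0ₛ e x N N<e) (≈-sym (shift-≈0ₛ e y N N<e))

gate-complement : ∀ n e x → gate (parity (suc n)) e x ⊕ gate (parity n) e x ≗ q^ e · x
gate-complement zero          e x m = ℤₚ.+-identityˡ _
gate-complement (suc zero)    e x m = ℤₚ.+-identityʳ _
gate-complement (suc (suc n)) e x   = gate-complement n e x

jacobiTerm : ℕ → ℕ → Series → Series
jacobiTerm a k = gate (parity (a + k)) (jacobiExponent a k)

jacobiTerm-multiplier : ∀ a k → IsMultiplier (jacobiTerm a k)
jacobiTerm-multiplier a k = gate-multiplier (parity (a + k)) (jacobiExponent a k)

jacobiTerm-shift : ∀ a u k c → a + u ≡ k + c → ∀ x → jacobiTerm u k (q^ a · x) ≗ q^ c · jacobiTerm a c x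
jacobiTerm-shift a u k c h x rewrite parity-swap a u k c h = go (parity (a + c))
  where
  go : ∀ p → gate p (jacobiExponent u k) (q^ a · x) ≗ q^ c · gate p (jacobiExponent a c) x
  go 0ℙ = begin
    q^ jacobiExponent u k · q^ a · x     ≈⟨ shift-shift (jacobiExponent u k) a x ⟩
    q^ (jacobiExponent u k + a) · x      ≈⟨ shift-exponent x (jacobiExponent-shift a u k c h) ⟩
    q^ (c + jacobiExponent a c) · x      ≈⟨ shift-shift c (jacobiExponent a c) x ⟨
    q^ c · q^ jacobiExponent a c · x     ∎
    where open ≗-Reasoning
  go 1ℙ = ≗-sym (shift-0ₛ c)

∑-pascal : ∀ (t : ℕ → Series → Series) → (∀ a → IsMultiplier (t a)) → ∀ m →
           (∑[ a ≤ suc m ] t a (qbinom (suc m) a))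
           ≗ (∑[ a ≤ m ] t a (qbinom m a)) ⊕ (∑[ a ≤ m ] t (suc a) (q^ (m ∸ a) · qbinom m a))
∑-pascal t Mt m = begin
  (∑[ a ≤ suc m ] t a (qbinom (suc m) a))
    ≈⟨ ∑-suc m _ ⟩
  t 0 (qbinom (suc m) 0) ⊕ (∑[ a ≤ m ] t (suc a) (qbinom (suc m) (suc a)))
    ≈⟨ ⊕-congˡ (t 0 (qbinom (suc m) 0)) (≗-trans (∑-cong m pascal) (∑-⊕ m A B)) ⟩
  t 0 (qbinom (suc m) 0) ⊕ (∑ m A ⊕ ∑ m B)
    ≈⟨ ⊕-assoc (t 0 (qbinom (suc m) 0)) (∑ m A) (∑ m B) ⟨
  t 0 (qbinom (suc m) 0) ⊕ ∑ m A ⊕ ∑ m B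
    ≈⟨ ⊕-congʳ (∑ m B) lower ⟩
  (∑[ a ≤ m ] t a (qbinom m a)) ⊕ ∑ m B ∎
  where
  open ≗-Reasoning
  A = λ a → t (suc a) (qbinom m (suc a))
  B = λ a → t (suc a) (q^ (m ∸ a) · qbinom m a)
  pascal : ∀ a → a ≤ m → t (suc a) (qbinom (suc m) (suc a)) ≗ A a ⊕ B a
  pascal a a≤m = ≗-trans (preserves-≗ (Mt (suc a)) (qbinom-pascal m a a≤m)) (⊕-homo (Mt (suc a)) _ _)
  top-vanishes : t (suc m) (qbinom m (suc m)) ≗ 0ₛ
  top-vanishes = ≗-trans (preserves-≗ (Mt (suc m)) (qbinom-> {m} ℕₚ.≤-refl)) (0ₛ-homo (Mt (suc m)))
  lower : t 0 (qbinom (suc m) 0) ⊕ ∑ m A ≗ (∑[ a ≤ m ] t a (qbinom m a))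
  lower = begin
    t 0 (qbinom (suc m) 0) ⊕ ∑ m A
      ≈⟨ ⊕-congʳ (∑ m A) (preserves-≗ (Mt 0) (≗-trans (qbinom-0 (suc m)) (≗-sym (qbinom-0 m)))) ⟩
    t 0 (qbinom m 0) ⊕ ∑ m A
      ≈⟨ ∑-suc m (λ a → t a (qbinom m a)) ⟨
    (∑[ a ≤ suc m ] t a (qbinom m a))
      ≈⟨ ⊕-congˡ (∑[ a ≤ m ] t a (qbinom m a)) top-vanishes ⟩
    (∑[ a ≤ m ] t a (qbinom m a)) ⊕ 0ₛ
      ≈⟨ ⊕-identityʳ _ ⟩
    (∑[ a ≤ m ] t a (qbinom m a)) ∎

qbinomSum : ℕ → Series
qbinomSum m = ∑[ a ≤ m ] q^ tri a · qbinom m a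

qbinomSum-suc : ∀ m → qbinomSum (suc m) ≗ ⟨1+q^ suc m ⟩· qbinomSum m
qbinomSum-suc m = ≗-trans (∑-pascal (λ a → q^ tri a ·_) (λ a → shift-multiplier (tri a)) m)
  (⊕-congˡ (qbinomSum m) (≗-trans (∑-cong m exponents) (≗-sym (multiplier-∑ (shift-multiplier (suc m)) m _))))
  where
  exponent : ∀ a → a ≤ m → tri (suc a) + (m ∸ a) ≡ suc m + tri a
  exponent a a≤m = begin
    (suc a + tri a) + (m ∸ a)    ≡⟨ cong (_+ (m ∸ a)) (ℕₚ.+-comm (suc a) (tri a)) ⟩
    (tri a + suc a) + (m ∸ a)    ≡⟨ ℕₚ.+-assoc (tri a) (suc a) (m ∸ a) ⟩
    tri a + suc (a + (m ∸ a))    ≡⟨ cong (λ x → tri a + suc x) (ℕₚ.m+[n∸m]≡n a≤m) ⟩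
    tri a + suc m                ≡⟨ ℕₚ.+-comm (tri a) (suc m) ⟩
    suc m + tri a                ∎
    where open ≡-Reasoning
  exponents : ∀ a → a ≤ m → q^ tri (suc a) · q^ (m ∸ a) · qbinom m a ≗ q^ suc m · q^ tri a · qbinom m a
  exponents a a≤m = ≗-trans (shift-shift (tri (suc a)) (m ∸ a) _)
    (≗-trans (shift-exponent _ (exponent a a≤m)) (≗-sym (shift-shift (suc m) (tri a) _)))

qbinomSum≗negPoch : ∀ m → qbinomSum m ≗ negPoch m 1ₛ
qbinomSum≗negPoch zero    = qbinom-0 0
qbinomSum≗negPoch (suc m) = ≗-trans (qbinomSum-suc m) (preserves-≗ (⟨1+q^⟩·-multiplier (suc m)) (qbinomSum≗negPoch m))

jacobiSum : ℕ → ℕ → Series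
jacobiSum m k = ∑[ a ≤ m ] jacobiTerm a k (qbinom m a)

jacobiSum-suc : ∀ m k → k ≤ suc m → jacobiSum (suc m) k ≗ jacobiSum m k ⊕ q^ (suc m ∸ k) · jacobiSum m (suc m ∸ k)
jacobiSum-suc m k k≤1+m = ≗-trans (∑-pascal (λ a → jacobiTerm a k) (λ a → jacobiTerm-multiplier a k) m)
  (⊕-congˡ (jacobiSum m k) (begin
    (∑[ a ≤ m ] jacobiTerm (suc a) k (q^ (m ∸ a) · qbinom m a))
      ≈⟨ ∑-reverse m _ ⟩
    (∑[ a ≤ m ] jacobiTerm (suc (m ∸ a)) k (q^ (m ∸ (m ∸ a)) · qbinom m (m ∸ a)))
      ≈⟨ ∑-cong m reflected ⟩
    (∑[ a ≤ m ] q^ c · jacobiTerm a c (qbinom m a))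
      ≈⟨ multiplier-∑ (shift-multiplier c) m _ ⟨
    q^ c · jacobiSum m c ∎))
  where
  open ≗-Reasoning
  c = suc m ∸ k
  balance : ∀ a → a ≤ m → a + suc (m ∸ a) ≡ k + c
  balance a a≤m = trans (ℕₚ.+-suc a (m ∸ a)) (trans (cong suc (ℕₚ.m+[n∸m]≡n a≤m)) (sym (ℕₚ.m+[n∸m]≡n k≤1+m)))
  reflected : ∀ a → a ≤ m → jacobiTerm (suc (m ∸ a)) k (q^ (m ∸ (m ∸ a)) · qbinom m (m ∸ a))
                            ≗ q^ c · jacobiTerm a c (qbinom m a)
  reflected a a≤m = ≗-trans (preserves-≗ (jacobiTerm-multiplier (suc (m ∸ a)) k)
                              (≗-trans (shift-exponent _ (ℕₚ.m∸[m∸n]≡n a≤m)) (shift-cong a (qbinom-symmetric m a a≤m))))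
                            (jacobiTerm-shift a (suc (m ∸ a)) k c (balance a a≤m) (qbinom m a))

jacobiTerm-0 : ∀ a x → jacobiTerm a 0 x ≗ gate (parity a) (tri a) x
jacobiTerm-0 a x n = cong₂ (λ p e → gate p e x n) (cong parity (ℕₚ.+-identityʳ a)) (cong triℤ (ℤₚ.+-identityʳ (+ a)))

jacobiTerm-opposite : ∀ m a x → a ≤ m → jacobiTerm (m ∸ a) (suc m) x ≗ gate (parity (suc a)) (tri a) x
jacobiTerm-opposite m a x a≤m n = cong₂ (λ p e → gate p e x n) same-parity exponent
  where
  balance : suc a + (m ∸ a) ≡ suc m + 0
  balance = trans (cong suc (ℕₚ.m+[n∸m]≡n a≤m)) (sym (ℕₚ.+-identityʳ (suc m)))
  same-parity : parity (m ∸ a + suc m) ≡ parity (suc a)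
  same-parity = trans (parity-swap (suc a) (m ∸ a) (suc m) 0 balance) (cong parity (ℕₚ.+-identityʳ (suc a)))
  exponent : jacobiExponent (m ∸ a) (suc m) ≡ tri a
  exponent = ℕₚ.+-cancelʳ-≡ (suc a) _ _ (begin
    jacobiExponent (m ∸ a) (suc m) + suc a   ≡⟨ jacobiExponent-shift (suc a) (m ∸ a) (suc m) 0 balance ⟩
    jacobiExponent (suc a) 0                 ≡⟨ cong triℤ (ℤₚ.+-identityʳ (+ suc a)) ⟩
    suc a + tri a                            ≡⟨ ℕₚ.+-comm (suc a) (tri a) ⟩
    tri a + suc a                            ∎)
    where open ≡-Reasoning

jacobiSum-ends : ∀ m → jacobiSum m (suc m) ⊕ jacobiSum m 0 ≗ qbinomSum m
jacobiSum-ends m = begin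
  jacobiSum m (suc m) ⊕ jacobiSum m 0       ≈⟨ ⊕-congʳ (jacobiSum m 0) (∑-reverse m _) ⟩
  (∑[ a ≤ m ] jacobiTerm (m ∸ a) (suc m) (qbinom m (m ∸ a))) ⊕ jacobiSum m 0
                                            ≈⟨ ∑-⊕ m _ _ ⟨
  (∑[ a ≤ m ] (jacobiTerm (m ∸ a) (suc m) (qbinom m (m ∸ a)) ⊕ jacobiTerm a 0 (qbinom m a)))
                                            ≈⟨ ∑-cong m term ⟩
  qbinomSum m                               ∎
  where
  open ≗-Reasoning
  term : ∀ a → a ≤ m → jacobiTerm (m ∸ a) (suc m) (qbinom m (m ∸ a)) ⊕ jacobiTerm a 0 (qbinom m a) ≗ q^ tri a · qbinom m a
  term a a≤m = ≗-trans (⊕-cong (≗-trans (preserves-≗ (jacobiTerm-multiplier (m ∸ a) (suc m)) (qbinom-symmetric m a a≤m))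
                                        (jacobiTerm-opposite m a _ a≤m))
                               (jacobiTerm-0 a _))
                       (gate-complement a (tri a) (qbinom m a))

jacobiSum≗negPoch² : ∀ n j j' → j + j' ≡ n → jacobiSum (suc n) (suc j) ≗ negPoch j (negPoch j' 1ₛ)
jacobiSum≗negPoch² n j zero j+0≡n rewrite ℕₚ.+-identityʳ j | j+0≡n = begin
  jacobiSum (suc n) (suc n)
    ≈⟨ jacobiSum-suc n (suc n) ℕₚ.≤-refl ⟩
  jacobiSum n (suc n) ⊕ q^ (n ∸ n) · jacobiSum n (n ∸ n)
    ≈⟨ ⊕-congˡ (jacobiSum n (suc n)) (λ x → cong (λ d → (q^ d · jacobiSum n d) x) (ℕₚ.n∸n≡0 n)) ⟩
  jacobiSum n (suc n) ⊕ jacobiSum n 0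
    ≈⟨ jacobiSum-ends n ⟩
  qbinomSum n
    ≈⟨ qbinomSum≗negPoch n ⟩
  negPoch n 1ₛ ∎
  where open ≗-Reasoning
jacobiSum≗negPoch² zero    j (suc j') j+j'≡0 = ⊥-elim (ℕₚ.1+n≢0 (trans (sym (ℕₚ.+-suc j j')) j+j'≡0))
jacobiSum≗negPoch² (suc n) j (suc j') j+1+j'≡1+n = begin
  jacobiSum (suc (suc n)) (suc j)
    ≈⟨ jacobiSum-suc (suc n) (suc j) j≤ ⟩
  jacobiSum (suc n) (suc j) ⊕ q^ (suc (suc n) ∸ suc j) · jacobiSum (suc n) (suc (suc n) ∸ suc j)
    ≈⟨ ⊕-congˡ (jacobiSum (suc n) (suc j)) (λ x → cong (λ d → (q^ d · jacobiSum (suc n) d) x) complement) ⟩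
  jacobiSum (suc n) (suc j) ⊕ q^ suc j' · jacobiSum (suc n) (suc j')
    ≈⟨ ⊕-cong (jacobiSum≗negPoch² n j j' j+j'≡n)
              (shift-cong (suc j') (jacobiSum≗negPoch² n j' j (trans (ℕₚ.+-comm j' j) j+j'≡n))) ⟩
  negPoch j (negPoch j' 1ₛ) ⊕ q^ suc j' · negPoch j' (negPoch j 1ₛ)
    ≈⟨ ⊕-congˡ (negPoch j (negPoch j' 1ₛ)) (shift-cong (suc j') (negPoch-central j' (negPoch-multiplier j) 1ₛ)) ⟩
  negPoch j (negPoch j' 1ₛ) ⊕ q^ suc j' · negPoch j (negPoch j' 1ₛ)
    ≈⟨ negPoch-central j (⟨1+q^⟩·-multiplier (suc j')) _ ⟨
  negPoch j (negPoch (suc j') 1ₛ) ∎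
  where
  open ≗-Reasoning
  j+j'≡n : j + j' ≡ n
  j+j'≡n = ℕₚ.suc-injective (trans (sym (ℕₚ.+-suc j j')) j+1+j'≡1+n)
  j≤ : suc j ≤ suc (suc n)
  j≤ = s≤s (subst (j ≤_) j+1+j'≡1+n (ℕₚ.m≤m+n j (suc j')))
  complement : suc (suc n) ∸ suc j ≡ suc j'
  complement = trans (cong (_∸ j) (sym j+1+j'≡1+n)) (ℕₚ.m+n∸m≡n j (suc j'))

gaussFactorᵖ : Parity → ℕ → Series → Series
gaussFactorᵖ 0ℙ k = ⟨1-q^ k ⟩·_
gaussFactorᵖ 1ℙ k = ⟨1-q^ k ⟩⁻¹·_

oddFactorᵖ : Parity → ℕ → Series → Series
oddFactorᵖ 0ℙ k a = a
oddFactorᵖ 1ℙ k   = ⟨1-q^ k ⟩⁻¹·_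

evenFactorᵖ : Parity → ℕ → Series → Series
evenFactorᵖ 0ℙ k   = ⟨1-q^ k ⟩·_
evenFactorᵖ 1ℙ k a = a

gauss : ℕ → Series → Series
gauss = ∏ λ k → gaussFactorᵖ (parity k) k

oddPoch⁻¹ : ℕ → Series → Series
oddPoch⁻¹ = ∏ λ k → oddFactorᵖ (parity k) k

evenPoch : ℕ → Series → Series
evenPoch = ∏ λ k → evenFactorᵖ (parity k) k

oddFactor-multiplier : ∀ k → IsMultiplier (oddFactorᵖ (parity k) k)
oddFactor-multiplier k = factor (parity k)
  where
  factor : ∀ p → IsMultiplier (oddFactorᵖ p k)
  factor 0ℙ = id-multiplier
  factor 1ℙ = ⁻¹·-multiplier k

oddPoch⁻¹-multiplier : ∀ m → IsMultiplier (oddPoch⁻¹ m)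
oddPoch⁻¹-multiplier = ∏-multiplier oddFactor-multiplier

oddPoch⁻¹-central : ∀ m → Central (oddPoch⁻¹ m)
oddPoch⁻¹-central = ∏-central oddFactor-multiplier λ k → factor (parity k) k
  where
  factor : ∀ p k → Central (oddFactorᵖ p k)
  factor 0ℙ k ML a = ≗-refl
  factor 1ℙ k     = ⁻¹·-central k

gauss-≈-truncate : ∀ m N a → N ≤ m → gauss m a ≈[ N ] gauss N a
gauss-≈-truncate = ∏-≈-truncate trivial
  where
  trivial : ∀ k a N → N < k → gaussFactorᵖ (parity k) k a ≈[ N ] a
  trivial k a N N<k with parity k
  ... | 0ℙ = ⟨1-q^⟩·-≈-id k a N N<k
  ... | 1ℙ = ⁻¹·-≈-id k a N N<k

evenPoch-≈-truncate : ∀ m N a → N ≤ m → evenPoch m a ≈[ N ] evenPoch N a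
evenPoch-≈-truncate = ∏-≈-truncate trivial
  where
  trivial : ∀ k a N → N < k → evenFactorᵖ (parity k) k a ≈[ N ] a
  trivial k a N N<k with parity k
  ... | 0ℙ = ⟨1-q^⟩·-≈-id k a N N<k
  ... | 1ℙ = ≈-refl

poch⁻¹-gauss : ∀ N a → poch⁻¹ N (gauss N a) ≗ oddPoch⁻¹ N (oddPoch⁻¹ N a)
poch⁻¹-gauss zero    a = ≗-refl
poch⁻¹-gauss (suc N) a with parity (suc N)
... | 0ℙ = begin
  D (poch⁻¹ N (⟨1-q^ suc N ⟩· gauss N a))
    ≈⟨ preserves-≗ (⁻¹·-multiplier (suc N)) (poch⁻¹-central N (⟨1-q^⟩·-multiplier (suc N)) _) ⟩
  D (⟨1-q^ suc N ⟩· poch⁻¹ N (gauss N a))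
    ≈⟨ ⟨1-q^⟩·-inverseˡ N _ ⟩
  poch⁻¹ N (gauss N a)
    ≈⟨ poch⁻¹-gauss N a ⟩
  oddPoch⁻¹ N (oddPoch⁻¹ N a) ∎
  where
  open ≗-Reasoning
  D = ⟨1-q^ suc N ⟩⁻¹·_
... | 1ℙ = begin
  D (poch⁻¹ N (D (gauss N a)))
    ≈⟨ preserves-≗ (⁻¹·-multiplier (suc N)) (poch⁻¹-central N (⁻¹·-multiplier (suc N)) _) ⟩
  D (D (poch⁻¹ N (gauss N a)))
    ≈⟨ preserves-≗ (⁻¹·-multiplier (suc N)) (preserves-≗ (⁻¹·-multiplier (suc N)) (poch⁻¹-gauss N a)) ⟩
  D (D (oddPoch⁻¹ N (oddPoch⁻¹ N a)))
    ≈⟨ preserves-≗ (⁻¹·-multiplier (suc N)) (oddPoch⁻¹-central N (⁻¹·-multiplier (suc N)) _) ⟨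
  D (oddPoch⁻¹ N (D (oddPoch⁻¹ N a))) ∎
  where
  open ≗-Reasoning
  D = ⟨1-q^ suc N ⟩⁻¹·_

difference-of-squares : ∀ k a → ⟨1-q^ k ⟩· ⟨1+q^ k ⟩· a ≗ ⟨1-q^ (k + k) ⟩· a
difference-of-squares k a n = begin
  (a n +ℤ x) +ℤ - (q^ k · (a ⊕ q^ k · a)) n
    ≡⟨ cong (λ z → (a n +ℤ x) +ℤ - z) (shift-⊕ k a (q^ k · a) n) ⟩
  (a n +ℤ x) +ℤ - (x +ℤ y)
    ≡⟨ solve 3 (λ a x y → (a :+ x) :+ (:- (x :+ y)) := a :+ (:- y)) refl (a n) x y ⟩
  a n +ℤ - y
    ≡⟨ cong (λ z → a n +ℤ - z) (shift-shift k k a n) ⟩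
  a n +ℤ - (q^ (k + k) · a) n ∎
  where
  open ≡-Reasoning
  x = (q^ k · a) n
  y = (q^ k · q^ k · a) n

⟨1+q^⟩·-as-quotient : ∀ k a → ⟨1+q^ suc k ⟩· a ≗ ⟨1-q^ suc k ⟩⁻¹· ⟨1-q^ (suc k + suc k) ⟩· a
⟨1+q^⟩·-as-quotient k a =
  ≗-trans (≗-sym (⟨1-q^⟩·-inverseˡ k _)) (preserves-≗ (⁻¹·-multiplier (suc k)) (difference-of-squares (suc k) a))

negPoch≗poch⁻¹-evenPoch : ∀ N a → negPoch N a ≗ poch⁻¹ N (evenPoch (N + N) a)
negPoch≗poch⁻¹-evenPoch zero    a = ≗-refl
negPoch≗poch⁻¹-evenPoch (suc N) a = begin
  ⟨1+q^ suc N ⟩· negPoch N a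
    ≈⟨ preserves-≗ (⟨1+q^⟩·-multiplier (suc N)) (negPoch≗poch⁻¹-evenPoch N a) ⟩
  ⟨1+q^ suc N ⟩· poch⁻¹ N (evenPoch (N + N) a)
    ≈⟨ ⟨1+q^⟩·-as-quotient N (poch⁻¹ N (evenPoch (N + N) a)) ⟩
  D (⟨1-q^ (suc N + suc N) ⟩· poch⁻¹ N (evenPoch (N + N) a))
    ≈⟨ preserves-≗ (⁻¹·-multiplier (suc N)) (poch⁻¹-central N (⟨1-q^⟩·-multiplier (suc N + suc N)) _) ⟨
  D (poch⁻¹ N (⟨1-q^ (suc N + suc N) ⟩· evenPoch (N + N) a))
    ≈⟨ preserves-≗ (⁻¹·-multiplier (suc N)) (preserves-≗ (poch⁻¹-multiplier N) top-factors) ⟩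
  D (poch⁻¹ N (evenPoch (suc N + suc N) a)) ∎
  where
  open ≗-Reasoning
  D = ⟨1-q^ suc N ⟩⁻¹·_
  top-factors : ⟨1-q^ (suc N + suc N) ⟩· evenPoch (N + N) a ≗ evenPoch (suc N + suc N) a
  top-factors rewrite ℕₚ.+-suc N N | parity-double N | parity-double+1 N = ≗-refl

poch⁻¹-evenPoch : ∀ N a → poch⁻¹ N (evenPoch N a) ≗ oddPoch⁻¹ N a
poch⁻¹-evenPoch zero    a = ≗-refl
poch⁻¹-evenPoch (suc N) a with parity (suc N)
... | 0ℙ = ≗-trans (preserves-≗ (⁻¹·-multiplier (suc N)) (poch⁻¹-central N (⟨1-q^⟩·-multiplier (suc N)) _))
                   (≗-trans (⟨1-q^⟩·-inverseˡ N _) (poch⁻¹-evenPoch N a))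
... | 1ℙ = preserves-≗ (⁻¹·-multiplier (suc N)) (poch⁻¹-evenPoch N a)

negPoch-≈-oddPoch⁻¹ : ∀ N a → negPoch N a ≈[ N ] oddPoch⁻¹ N a
negPoch-≈-oddPoch⁻¹ N a = begin
  negPoch N a
    ≈⟨ ≗⇒≈ (negPoch≗poch⁻¹-evenPoch N a) ⟩
  poch⁻¹ N (evenPoch (N + N) a)
    ≈⟨ preserves-≈ (poch⁻¹-multiplier N) (evenPoch-≈-truncate (N + N) N a (ℕₚ.m≤m+n N N)) ⟩
  poch⁻¹ N (evenPoch N a)
    ≈⟨ ≗⇒≈ (poch⁻¹-evenPoch N a) ⟩
  oddPoch⁻¹ N a ∎
  where open ≈-Reasoning N

centre width : ℕ → ℕ
centre N = suc (N + N)
width  N = suc ((N + N) + (N + N))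

width≡ : ∀ N → width N ≡ (centre N + N) + N
width≡ N = cong suc (sym (ℕₚ.+-assoc (N + N) N N))

small-exponent⇒central-index : ∀ N a → jacobiExponent a (centre N) ≤ N → N ≤ a × a + N ≤ width N
small-exponent⇒central-index N a e≤N with jacobiExponent-cases a (centre N)
... | inj₁ (x , refl , e≡tri) = N≤a , a+N≤width
  where
  x≤N : x ≤ N
  x≤N = ℕₚ.≤-trans (n≤tri x) (subst (_≤ N) e≡tri e≤N)
  N≤a : N ≤ centre N + x
  N≤a = ℕₚ.≤-trans (ℕₚ.m≤n⇒m≤1+n (ℕₚ.m≤m+n N N)) (ℕₚ.m≤m+n (centre N) x)
  a+N≤width : (centre N + x) + N ≤ width N
  a+N≤width = subst ((centre N + x) + N ≤_) (sym (width≡ N)) (ℕₚ.+-monoˡ-≤ N (ℕₚ.+-monoʳ-≤ (centre N) x≤N))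
... | inj₂ (x , a+1+x≡c , e≡tri) = N≤a , a+N≤width
  where
  x≤N : x ≤ N
  x≤N = ℕₚ.≤-trans (n≤tri x) (subst (_≤ N) e≡tri e≤N)
  a+x≡2N : a + x ≡ N + N
  a+x≡2N = ℕₚ.suc-injective (trans (sym (ℕₚ.+-suc a x)) a+1+x≡c)
  N≤a : N ≤ a
  N≤a = ℕₚ.+-cancelʳ-≤ N N a (subst (_≤ a + N) a+x≡2N (ℕₚ.+-monoʳ-≤ a x≤N))
  a≤2N : a ≤ N + N
  a≤2N = subst (a ≤_) a+x≡2N (ℕₚ.m≤m+n a x)
  a+N≤width : a + N ≤ width N
  a+N≤width = ℕₚ.≤-trans (ℕₚ.+-monoˡ-≤ N a≤2N)
    (subst ((N + N) + N ≤_) (sym (width≡ N))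
      (ℕₚ.+-monoˡ-≤ N (ℕₚ.≤-trans (ℕₚ.n≤1+n (N + N)) (ℕₚ.m≤m+n (centre N) N))))

thetaSum : ℕ → Series
thetaSum N = ∑[ a ≤ width N ] jacobiTerm a (centre N) 1ₛ

jacobiSum-≈-thetaSum : ∀ N → jacobiSum (width N) (centre N) ≈[ N ] poch⁻¹ N (thetaSum N)
jacobiSum-≈-thetaSum N = begin
  jacobiSum (width N) (centre N)
    ≈⟨ ∑-≈ (width N) limit ⟩
  (∑[ a ≤ width N ] jacobiTerm a (centre N) (poch⁻¹ N 1ₛ))
    ≈⟨ ≗⇒≈ (∑-cong (width N) λ a _ → central a) ⟩
  (∑[ a ≤ width N ] poch⁻¹ N (jacobiTerm a (centre N) 1ₛ))
    ≈⟨ ≗⇒≈ (multiplier-∑ (poch⁻¹-multiplier N) (width N) _) ⟨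
  poch⁻¹ N (thetaSum N) ∎
  where
  open ≈-Reasoning N
  limit : ∀ a → a ≤ width N → jacobiTerm a (centre N) (qbinom (width N) a) ≈[ N ] jacobiTerm a (centre N) (poch⁻¹ N 1ₛ)
  limit a a≤w = gate-≈ (parity (a + centre N)) (jacobiExponent a (centre N)) λ e≤N →
    let N≤a , a+N≤w = small-exponent⇒central-index N a e≤N in
    qbinom-≈-limit (width N) a N a≤w N≤a (subst (_≤ width N ∸ a) (ℕₚ.m+n∸m≡n a N) (ℕₚ.∸-monoˡ-≤ a a+N≤w))
  central : ∀ a → jacobiTerm a (centre N) (poch⁻¹ N 1ₛ) ≗ poch⁻¹ N (jacobiTerm a (centre N) 1ₛ)
  central a = gate-central (parity (a + centre N)) (jacobiExponent a (centre N)) (poch⁻¹-multiplier N) 1ₛ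

-- Gauss's identity up to degree N; thetaSum N is a truncation of ∑ₜ q^(t(t+1)/2).
gauss-≈-thetaSum : ∀ N → gauss N 1ₛ ≈[ N ] thetaSum N
gauss-≈-thetaSum N = begin
  gauss N 1ₛ                                     ≈⟨ ≗⇒≈ (poch-poch⁻¹ N _) ⟨
  poch N (poch⁻¹ N (gauss N 1ₛ))                 ≈⟨ preserves-≈ (poch-multiplier N) divided ⟩
  poch N (poch⁻¹ N (thetaSum N))                 ≈⟨ ≗⇒≈ (poch-poch⁻¹ N _) ⟩
  thetaSum N                                     ∎
  where
  open ≈-Reasoning N
  M = N + N
  euler² : negPoch N (negPoch N 1ₛ) ≈[ N ] oddPoch⁻¹ N (oddPoch⁻¹ N 1ₛ)
  euler² = ≈-trans (negPoch-≈-oddPoch⁻¹ N _) (preserves-≈ (oddPoch⁻¹-multiplier N) (negPoch-≈-oddPoch⁻¹ N 1ₛ))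
  truncate² : negPoch M (negPoch M 1ₛ) ≈[ N ] negPoch N (negPoch N 1ₛ)
  truncate² = ≈-trans (negPoch-≈-truncate M N _ (ℕₚ.m≤m+n N N))
                      (preserves-≈ (negPoch-multiplier N) (negPoch-≈-truncate M N 1ₛ (ℕₚ.m≤m+n N N)))
  divided : poch⁻¹ N (gauss N 1ₛ) ≈[ N ] poch⁻¹ N (thetaSum N)
  divided = begin
    poch⁻¹ N (gauss N 1ₛ)
      ≈⟨ ≗⇒≈ (poch⁻¹-gauss N 1ₛ) ⟩
    oddPoch⁻¹ N (oddPoch⁻¹ N 1ₛ)
      ≈⟨ euler² ⟨
    negPoch N (negPoch N 1ₛ)
      ≈⟨ truncate² ⟨
    negPoch M (negPoch M 1ₛ)
      ≈⟨ ≗⇒≈ (jacobiSum≗negPoch² (M + M) M M refl) ⟨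
    jacobiSum (width N) (centre N)
      ≈⟨ jacobiSum-≈-thetaSum N ⟩
    poch⁻¹ N (thetaSum N) ∎

Hit : ℕ → ℕ → ℕ → Set
Hit a k n = parity (a + k) ≡ 0ℙ × jacobiExponent a k ≡ n

jacobiTerm-1ₛ-hit : ∀ a k n → Hit a k n → jacobiTerm a k 1ₛ n ≡ 1ℤ
jacobiTerm-1ₛ-hit a k n (even , refl) rewrite even = shift-1ₛ-diagonal (jacobiExponent a k)

jacobiTerm-1ₛ-miss : ∀ a k n → ¬ Hit a k n → jacobiTerm a k 1ₛ n ≡ 0ℤ
jacobiTerm-1ₛ-miss a k n miss with parity (a + k)
... | 1ℙ = refl
... | 0ℙ = shift-1ₛ-off-diagonal (jacobiExponent a k) n λ e≡n → miss (refl , e≡n)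

-- As d runs over the even integers, T(d) takes each triangular value tri t exactly once:
-- at d = t for even t and at d = -1-t for odd t.
Placement : ℕ → ℕ → ℕ → Set
Placement a k t = (a ≡ k + t × parity t ≡ 0ℙ) ⊎ (a + suc t ≡ k × parity (suc t) ≡ 0ℙ)

hit-placement : ∀ a k n → Hit a k n → ∃ λ t → tri t ≡ n × Placement a k t
hit-placement a k n (even , e≡n) with jacobiExponent-cases a k
... | inj₁ (t , refl , e≡t) = t , trans (sym e≡t) e≡n , inj₁ (refl , trans (sym (parity-above k t)) even)
... | inj₂ (t , refl , e≡t) = t , trans (sym e≡t) e≡n , inj₂ (refl , trans (sym (parity-below a t)) even)

hit-unique : ∀ {a a' k n} → Hit a k n → Hit a' k n → a ≡ a'
hit-unique {a} {a'} {k} {n} h h' with hit-placement a k n h | hit-placement a' k n h'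
... | t , tt≡n , p | t' , tt'≡n , p' with tri-injective {t} {t'} (trans tt≡n (sym tt'≡n))
... | refl with p | p'
... | inj₁ (a≡ , _)    | inj₁ (a'≡ , _)    = trans a≡ (sym a'≡)
... | inj₂ (a≡ , _)    | inj₂ (a'≡ , _)    = ℕₚ.+-cancelʳ-≡ (suc t) a a' (trans a≡ (sym a'≡))
... | inj₁ (_ , even)  | inj₂ (_ , even') = ⊥-elim (parity-suc-≢ t (trans even' (sym even)))
... | inj₂ (_ , even') | inj₁ (_ , even)  = ⊥-elim (parity-suc-≢ t (trans even' (sym even)))

triangular⇒hit : ∀ k t → t < k → ∃ λ a → a ≤ k + t × Hit a k (tri t)
triangular⇒hit k t t<k with parity t in pt
... | 0ℙ = k + t , ℕₚ.≤-refl , trans (parity-above k t) pt , jacobiExponent-above k t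
... | 1ℙ = a , ℕₚ.≤-trans (ℕₚ.m∸n≤m k (suc t)) (ℕₚ.m≤m+n k t) , even , exponent
  where
  a = k ∸ suc t
  a+1+t≡k : a + suc t ≡ k
  a+1+t≡k = ℕₚ.m∸n+n≡m t<k
  even : parity (a + k) ≡ 0ℙ
  even = subst (λ k → parity (a + k) ≡ 0ℙ) a+1+t≡k (trans (parity-below a t) (parity-suc-flip t pt))
  exponent : jacobiExponent a k ≡ tri t
  exponent = subst (λ k → jacobiExponent a k ≡ tri t) a+1+t≡k (jacobiExponent-below a t)

thetaSum-coefficient-triangular : ∀ N t → tri t ≡ N → thetaSum N N ≡ 1ℤ
thetaSum-coefficient-triangular N t refl =
  let a , a≤k+t , hit = triangular⇒hit (centre N) t t<centre in trans
  (∑-coefficient-single (width N) (λ a → jacobiTerm a (centre N) 1ₛ) N a (within a≤k+t)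
    λ a' _ a'≢a → jacobiTerm-1ₛ-miss a' (centre N) N λ hit' → a'≢a (hit-unique hit' hit))
  (jacobiTerm-1ₛ-hit a (centre N) N hit)
  where
  t<centre : t < centre N
  t<centre = s≤s (ℕₚ.≤-trans (n≤tri t) (ℕₚ.m≤m+n (tri t) (tri t)))
  within : ∀ {a} → a ≤ centre N + t → a ≤ width N
  within a≤k+t = ℕₚ.≤-trans a≤k+t (subst (centre N + t ≤_) (sym (width≡ N))
    (ℕₚ.≤-trans (ℕₚ.+-monoʳ-≤ (centre N) (n≤tri t)) (ℕₚ.m≤m+n (centre N + tri t) (tri t))))

thetaSum-coefficient-non-triangular : ∀ N → (∀ t → tri t ≢ N) → thetaSum N N ≡ 0ℤ
thetaSum-coefficient-non-triangular N not-tri = ∑-coefficient-0 (width N) _ N λ a _ →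
  jacobiTerm-1ₛ-miss a (centre N) N λ hit → let t , tri-t≡N , _ = hit-placement a (centre N) N hit in not-tri t tri-t≡N

mult-here : ∀ x π → mult x (x ∷ π) ≡ suc (mult x π)
mult-here x π = cong length (filter-accept (x ℕₚ.≟_) refl)

mult-there : ∀ {p x} π → p ≢ x → mult p (x ∷ π) ≡ mult p π
mult-there π p≢x = cong length (filter-reject (_ ℕₚ.≟_) p≢x)

mult-∷-≥ : ∀ p x π → mult p π ≤ mult p (x ∷ π)
mult-∷-≥ p x π with p ℕₚ.≟ x
... | yes refl = subst (mult p π ≤_) (sym (mult-here p π)) (ℕₚ.n≤1+n _)
... | no  p≢x  = ℕₚ.≤-reflexive (sym (mult-there π p≢x))

mult-absent : ∀ {p} π → All (_< p) π → mult p π ≡ 0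
mult-absent []      []         = refl
mult-absent (y ∷ π) (y<p ∷ ys) = trans (mult-there π (ℕₚ.<⇒≢ y<p ∘ sym)) (mult-absent π ys)

InPₑ-singleton : ∀ {x} → 2 ∣ x → 1 ≤ x → InPₑ [ x ]
InPₑ-singleton {x} x-even 1≤x = ([-] , 1≤x ∷ []) , (λ p _ → length-filter (p ℕₚ.≟_) [ x ]) , (x , refl , x-even)

InPₑ-∷ : ∀ {x y π} → InPₑ (y ∷ π) → y ≤ x → (2 ∣ x → All (_< x) (y ∷ π)) → InPₑ (x ∷ y ∷ π)
InPₑ-∷ {x} {y} {π} ((linked , 1≤y ∷ positive) , mult≤1 , smallest) y≤x even⇒above =
  (y≤x ∷ linked , ℕₚ.≤-trans 1≤y y≤x ∷ 1≤y ∷ positive) , mult≤1′ , smallest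
  where
  mult≤1′ : ∀ p → 2 ∣ p → mult p (x ∷ y ∷ π) ≤ 1
  mult≤1′ p p-even with p ℕₚ.≟ x
  ... | yes refl = ℕₚ.≤-reflexive (trans (mult-here p (y ∷ π)) (cong suc (mult-absent (y ∷ π) (even⇒above p-even))))
  ... | no  p≢x  = subst (_≤ 1) (sym (mult-there (y ∷ π) p≢x)) (mult≤1 p p-even)

InPₑ-tail : ∀ {x y π} → InPₑ (x ∷ y ∷ π) → InPₑ (y ∷ π)
InPₑ-tail {x} {y} {π} ((_ ∷ linked , _ ∷ positive) , mult≤1 , smallest) =
  (linked , positive) , (λ p p-even → ℕₚ.≤-trans (mult-∷-≥ p x (y ∷ π)) (mult≤1 p p-even)) , smallest

-- Pₑ b N π: π ∈ 𝒫ₑ, |π| = N and all parts are ≤ b, generated by adding the largest part.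
data Pₑ : ℕ → ℕ → List ℕ → Set where
  lower  : ∀ {b N π} → Pₑ b N π → Pₑ (suc b) N π
  single : ∀ {b} → parity (suc b) ≡ 0ℙ → Pₑ (suc b) (suc b) [ suc b ]
  even∷  : ∀ {b M π} → parity (suc b) ≡ 0ℙ → Pₑ b M π → Pₑ (suc b) (suc b + M) (suc b ∷ π)
  odd∷   : ∀ {b M π} → parity (suc b) ≡ 1ℙ → Pₑ (suc b) M π → Pₑ (suc b) (suc b + M) (suc b ∷ π)

Pₑ-nonempty : ∀ {b N π} → Pₑ b N π → ∃[ x ] ∃[ ρ ] π ≡ x ∷ ρ
Pₑ-nonempty (lower p)            = Pₑ-nonempty p
Pₑ-nonempty (single {b} _)       = suc b , [] , refl
Pₑ-nonempty (even∷ {b} {π = π} _ _) = suc b , π , refl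
Pₑ-nonempty (odd∷ {b} {π = π} _ _)  = suc b , π , refl

Pₑ-sound : ∀ {b N π} → Pₑ b N π → InPₑ π × ∣ π ∣ₚ ≡ N × All (_≤ b) π
Pₑ-sound (lower p) with Pₑ-sound p
... | inPₑ , size , bounded = inPₑ , size , All.map ℕₚ.m≤n⇒m≤1+n bounded
Pₑ-sound (single {b} 1+b-even) =
  InPₑ-singleton (parity≡0ℙ⇒∣ (suc b) 1+b-even) (s≤s z≤n) , ℕₚ.+-identityʳ (suc b) , ℕₚ.≤-refl ∷ []
Pₑ-sound (even∷ {b} e p) with Pₑ-sound p | Pₑ-nonempty p
... | inPₑ , size , y≤b ∷ bounded | _ , _ , refl =
  InPₑ-∷ inPₑ (ℕₚ.m≤n⇒m≤1+n y≤b) (λ _ → All.map s≤s (y≤b ∷ bounded)) , cong (λ M → suc b + M) size ,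
  ℕₚ.≤-refl ∷ All.map ℕₚ.m≤n⇒m≤1+n (y≤b ∷ bounded)
Pₑ-sound (odd∷ {b} o p) with Pₑ-sound p | Pₑ-nonempty p
... | inPₑ , size , y≤1+b ∷ bounded | _ , _ , refl =
  InPₑ-∷ inPₑ y≤1+b (⊥-elim ∘ parity≡1ℙ⇒∤ o) , cong (λ M → suc b + M) size , ℕₚ.≤-refl ∷ y≤1+b ∷ bounded

Pₑ-raise : ∀ {b b' N π} → b ≤ b' → Pₑ b N π → Pₑ b' N π
Pₑ-raise {b} {b'} b≤b' p with ℕₚ.m≤n⇒m<n∨m≡n b≤b'
... | inj₂ refl = p
... | inj₁ (s≤s b≤b'-1) = lower (Pₑ-raise b≤b'-1 p)

Pₑ-largest : ∀ x ρ → InPₑ (x ∷ ρ) → Pₑ x (x + sum ρ) (x ∷ ρ)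
Pₑ-largest zero ρ ((_ , () ∷ _) , _)
Pₑ-largest (suc b) [] (_ , _ , _ , refl , 2∣1+b) =
  subst (λ N → Pₑ (suc b) N [ suc b ]) (sym (ℕₚ.+-identityʳ (suc b))) (single (∣⇒parity≡0ℙ 2∣1+b))
Pₑ-largest (suc b) (y ∷ ρ) inPₑ@((y≤1+b ∷ _ , _) , mult≤1 , _) with parity (suc b) in p
... | 0ℙ = even∷ p (Pₑ-raise (ℕₚ.≤-pred (ℕₚ.≤∧≢⇒< y≤1+b y≢1+b)) (Pₑ-largest y ρ (InPₑ-tail inPₑ)))
  where
  y≢1+b : y ≢ suc b
  y≢1+b refl = ℕₚ.<⇒≱ (s≤s (s≤s z≤n)) (subst (_≤ 1) (trans (mult-here y (y ∷ ρ)) (cong suc (mult-here y ρ)))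
                                                    (mult≤1 y (parity≡0ℙ⇒∣ y p)))
... | 1ℙ = odd∷ p (Pₑ-raise y≤1+b (Pₑ-largest y ρ (InPₑ-tail inPₑ)))

Pₑ-complete : ∀ b {N} π → InPₑ π × ∣ π ∣ₚ ≡ N × All (_≤ b) π → Pₑ b N π
Pₑ-complete b []      ((_ , _ , _ , () , _) , _)
Pₑ-complete b (x ∷ ρ) (inPₑ , refl , x≤b ∷ _) = Pₑ-raise x≤b (Pₑ-largest x ρ inPₑ)

singletonIf : ∀ {x N} → Dec (N ≡ x) → List (List ℕ)
singletonIf {x} (yes _) = [ [ x ] ]
singletonIf     (no  _) = []

-- All partitions counted by Pₑ b N; the fuel f only has to be ≥ N.
mutual
  enumerate : ℕ → ℕ → ℕ → List (List ℕ)
  enumerate f zero    N = []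
  enumerate f (suc b) N = enumerate f b N ++ enumerateLargest (parity (suc b)) f b N

  enumerateLargest : Parity → ℕ → ℕ → ℕ → List (List ℕ)
  enumerateLargest 0ℙ f       b N = singletonIf (N ℕₚ.≟ suc b) ++ map (suc b ∷_) (enumerate f b (N ∸ suc b))
  enumerateLargest 1ℙ zero    b N = []
  enumerateLargest 1ℙ (suc f) b N = map (suc b ∷_) (enumerate f (suc b) (N ∸ suc b))

Pₑ-positive : ∀ {b N π} → Pₑ b N π → 0 < N
Pₑ-positive (lower p)    = Pₑ-positive p
Pₑ-positive (single _)   = s≤s z≤n
Pₑ-positive (even∷ _ _)   = s≤s z≤n
Pₑ-positive (odd∷ _ _)   = s≤s z≤n

Pₑ-∸ : ∀ {b c N π} → Pₑ c (N ∸ suc b) π → suc b + (N ∸ suc b) ≡ N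
Pₑ-∸ {b} {N = N} p with ℕₚ.≤-<-connex (suc b) N
... | inj₁ 1+b≤N = ℕₚ.m+[n∸m]≡n 1+b≤N
... | inj₂ N<1+b = ⊥-elim (ℕₚ.<⇒≢ (Pₑ-positive p) (sym (ℕₚ.m≤n⇒m∸n≡0 (ℕₚ.<⇒≤ N<1+b))))

mutual
  enumerate-sound : ∀ f b N π → π ∈ enumerate f b N → Pₑ b N π
  enumerate-sound f zero    N π ()
  enumerate-sound f (suc b) N π π∈ with ∈-++⁻ (enumerate f b N) π∈
  ... | inj₁ π∈lower   = lower (enumerate-sound f b N π π∈lower)
  ... | inj₂ π∈largest = enumerateLargest-sound (parity (suc b)) f b N π refl π∈largest

  enumerateLargest-sound : ∀ p f b N π → parity (suc b) ≡ p → π ∈ enumerateLargest p f b N → Pₑ (suc b) N π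
  enumerateLargest-sound 0ℙ f b N π e π∈ with ∈-++⁻ (singletonIf (N ℕₚ.≟ suc b)) π∈
  ... | inj₁ π∈single = single-sound (N ℕₚ.≟ suc b) π∈single
    where
    single-sound : ∀ d → π ∈ singletonIf d → Pₑ (suc b) N π
    single-sound (yes refl) (here refl) = single e
    single-sound (no _)     ()
  ... | inj₂ π∈rest with ∈-map⁻ (suc b ∷_) π∈rest
  ...   | ρ , ρ∈ , refl = let p = enumerate-sound f b (N ∸ suc b) ρ ρ∈ in
                          subst (λ N → Pₑ (suc b) N (suc b ∷ ρ)) (Pₑ-∸ p) (even∷ e p)
  enumerateLargest-sound 1ℙ (suc f) b N π e π∈ with ∈-map⁻ (suc b ∷_) π∈
  ... | ρ , ρ∈ , refl = let p = enumerate-sound f (suc b) (N ∸ suc b) ρ ρ∈ in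
                        subst (λ N → Pₑ (suc b) N (suc b ∷ ρ)) (Pₑ-∸ p) (odd∷ e p)

enumerate-complete : ∀ {b N π} → Pₑ b N π → ∀ f → N ≤ f → π ∈ enumerate f b N
enumerate-complete (lower p) f N≤f = ∈-++⁺ˡ (enumerate-complete p f N≤f)
enumerate-complete (single {b} e) f _ =
  ∈-++⁺ʳ (enumerate f b (suc b)) (subst (λ p → [ suc b ] ∈ enumerateLargest p f b (suc b)) (sym e) (∈-++⁺ˡ here-single))
  where
  here-single : [ suc b ] ∈ singletonIf (suc b ℕₚ.≟ suc b)
  here-single with suc b ℕₚ.≟ suc b
  ... | yes refl    = here refl
  ... | no  1+b≢1+b = ⊥-elim (1+b≢1+b refl)
enumerate-complete (even∷ {b} {M} {π} e p) f N≤f =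
  ∈-++⁺ʳ (enumerate f b (suc b + M)) (subst (λ p → (suc b ∷ π) ∈ enumerateLargest p f b (suc b + M)) (sym e)
    (∈-++⁺ʳ (singletonIf _) (∈-map⁺ (suc b ∷_) (subst (λ N → π ∈ enumerate f b N) (sym (ℕₚ.m+n∸m≡n (suc b) M))
      (enumerate-complete p f (ℕₚ.≤-trans (ℕₚ.m≤n+m M (suc b)) N≤f))))))
enumerate-complete (odd∷ {b} {M} {π} o p) (suc f) (s≤s N≤f) =
  ∈-++⁺ʳ (enumerate (suc f) b (suc b + M)) (subst (λ p → (suc b ∷ π) ∈ enumerateLargest p (suc f) b (suc b + M)) (sym o)
    (∈-map⁺ (suc b ∷_) (subst (λ N → π ∈ enumerate f (suc b) N) (sym (ℕₚ.m+n∸m≡n (suc b) M))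
      (enumerate-complete p f (ℕₚ.≤-trans (ℕₚ.m≤n+m M b) N≤f)))))

enumerateLargest-head : ∀ p f b N π → π ∈ enumerateLargest p f b N → ∃[ ρ ] π ≡ suc b ∷ ρ
enumerateLargest-head 0ℙ f b N π π∈ with ∈-++⁻ (singletonIf (N ℕₚ.≟ suc b)) π∈
... | inj₁ π∈single = single-head (N ℕₚ.≟ suc b) π∈single
  where
  single-head : ∀ d → π ∈ singletonIf d → ∃[ ρ ] π ≡ suc b ∷ ρ
  single-head (yes _) (here refl) = [] , refl
  single-head (no _)  ()
... | inj₂ π∈rest = let ρ , _ , π≡ = ∈-map⁻ (suc b ∷_) π∈rest in ρ , π≡
enumerateLargest-head 1ℙ (suc f) b N π π∈ = let ρ , _ , π≡ = ∈-map⁻ (suc b ∷_) π∈ in ρ , π≡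

singletonIf-unique : ∀ {x N} (d : Dec (N ≡ x)) → Unique (singletonIf d)
singletonIf-unique (yes _) = [] ∷ []
singletonIf-unique (no _)  = []

mutual
  enumerate-unique : ∀ f b N → Unique (enumerate f b N)
  enumerate-unique f zero    N = []
  enumerate-unique f (suc b) N =
    ++⁺ (enumerate-unique f b N) (enumerateLargest-unique (parity (suc b)) f b N) lower-disjoint
    where
    lower-disjoint : Disjoint (enumerate f b N) (enumerateLargest (parity (suc b)) f b N)
    lower-disjoint (π∈lower , π∈largest) with enumerateLargest-head (parity (suc b)) f b N _ π∈largest
    ... | ρ , refl with Pₑ-sound (enumerate-sound f b N _ π∈lower)
    ...   | _ , _ , 1+b≤b ∷ _ = ℕₚ.<-irrefl refl 1+b≤b

  enumerateLargest-unique : ∀ p f b N → Unique (enumerateLargest p f b N)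
  enumerateLargest-unique 0ℙ f b N =
    ++⁺ (singletonIf-unique (N ℕₚ.≟ suc b)) (map⁺ ∷-injectiveʳ (enumerate-unique f b (N ∸ suc b)))
        (single-disjoint (N ℕₚ.≟ suc b))
    where
    single-disjoint : ∀ d → Disjoint (singletonIf d) (map (suc b ∷_) (enumerate f b (N ∸ suc b)))
    single-disjoint (yes _) (here refl , π∈rest) with ∈-map⁻ (suc b ∷_) π∈rest
    ... | ρ , ρ∈ , π≡ with Pₑ-nonempty (enumerate-sound f b (N ∸ suc b) ρ ρ∈)
    ...   | _ , _ , refl with ∷-injectiveʳ π≡
    ...     | ()
    single-disjoint (no _)  (() , _)
  enumerateLargest-unique 1ℙ zero    b N = []
  enumerateLargest-unique 1ℙ (suc f) b N = map⁺ ∷-injectiveʳ (enumerate-unique f (suc b) (N ∸ suc b))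

signedSum-↭ : ∀ {ps qs} → ps ↭ qs → signedSum ps ≡ signedSum qs
signedSum-↭ ↭.refl          = refl
signedSum-↭ (↭.prep π p)    = cong (sgn (suc (νₑ π)) +ℤ_) (signedSum-↭ p)
signedSum-↭ (↭.swap {ps} π σ p) = trans
  (solve 3 (λ a b c → a :+ (b :+ c) := b :+ (a :+ c)) refl (sgn (suc (νₑ π))) (sgn (suc (νₑ σ))) (signedSum ps))
  (cong (λ s → sgn (suc (νₑ σ)) +ℤ (sgn (suc (νₑ π)) +ℤ s)) (signedSum-↭ p))
signedSum-↭ (↭.trans p q)   = trans (signedSum-↭ p) (signedSum-↭ q)

signedSum-set : ∀ {ps qs} → Unique ps → Unique qs → (∀ π → π ∈ ps ⇔ π ∈ qs) → signedSum ps ≡ signedSum qs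
signedSum-set ups uqs same = signedSum-↭ (∼bag⇒↭ (unique∧set⇒bag ups uqs λ {π} → same π))

signedSum-++ : ∀ ps qs → signedSum (ps ++ qs) ≡ signedSum ps +ℤ signedSum qs
signedSum-++ []       qs = sym (ℤₚ.+-identityˡ _)
signedSum-++ (π ∷ ps) qs = trans (cong (sgn (suc (νₑ π)) +ℤ_) (signedSum-++ ps qs))
                                   (sym (ℤₚ.+-assoc (sgn (suc (νₑ π))) (signedSum ps) (signedSum qs)))

signedSum-map-∷-even : ∀ x ps → 2 ∣ x → signedSum (map (x ∷_) ps) ≡ - signedSum ps
signedSum-map-∷-even x []       _ = refl
signedSum-map-∷-even x (π ∷ ps) 2∣x = trans
  (cong₂ _+ℤ_ (cong (sgn ∘ suc) (cong length (filter-accept (2 ∣?_) 2∣x))) (signedSum-map-∷-even x ps 2∣x))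
  (sym (ℤₚ.neg-distrib-+ (sgn (suc (νₑ π))) (signedSum ps)))

signedSum-map-∷-odd : ∀ x ps → ¬ 2 ∣ x → signedSum (map (x ∷_) ps) ≡ signedSum ps
signedSum-map-∷-odd x []       _ = refl
signedSum-map-∷-odd x (π ∷ ps) 2∤x =
  cong₂ _+ℤ_ (cong (λ n → sgn (suc n)) (cong length (filter-reject (2 ∣?_) 2∤x))) (signedSum-map-∷-odd x ps 2∤x)

enumerate-fuel : ∀ f f' b N → N ≤ f → N ≤ f' → signedSum (enumerate f b N) ≡ signedSum (enumerate f' b N)
enumerate-fuel f f' b N N≤f N≤f' = signedSum-set (enumerate-unique f b N) (enumerate-unique f' b N) λ π →
  mk⇔ (λ π∈ → enumerate-complete (enumerate-sound f b N π π∈) f' N≤f')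
      (λ π∈ → enumerate-complete (enumerate-sound f' b N π π∈) f N≤f)

-- The coefficient of q^N is the signed count of π ∈ 𝒫ₑ with |π| = N and all parts ≤ b.
signedSeries : ℕ → Series
signedSeries b N = signedSum (enumerate N b N)

signedSeries-0 : ∀ b → signedSeries b 0 ≡ 0ℤ
signedSeries-0 b = cong signedSum (empty (enumerate 0 b 0) (enumerate-sound 0 b 0))
  where
  empty : ∀ ps → (∀ π → π ∈ ps → Pₑ b 0 π) → ps ≡ []
  empty []       _       = refl
  empty (π ∷ ps) counted = ⊥-elim (ℕₚ.<-irrefl refl (Pₑ-positive (counted π (here refl))))

shift-signedSeries : ∀ k c n → (q^ k · signedSeries c) n ≡ signedSeries c (n ∸ k)
shift-signedSeries k c n with ℕₚ.≤-<-connex k n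
... | inj₁ k≤n = shift-above k (signedSeries c) n k≤n
... | inj₂ n<k = trans (shift-below k (signedSeries c) n n<k)
                         (trans (sym (signedSeries-0 c)) (cong (signedSeries c) (sym (ℕₚ.m≤n⇒m∸n≡0 (ℕₚ.<⇒≤ n<k)))))

signedSeries-suc : ∀ b n → signedSeries (suc b) n ≡ signedSeries b n +ℤ signedSum (enumerateLargest (parity (suc b)) n b n)
signedSeries-suc b n = signedSum-++ (enumerate n b n) _

-- An odd largest part may be repeated.
signedSeries-odd : ∀ b → parity (suc b) ≡ 1ℙ → signedSeries (suc b) ≗ signedSeries b ⊕ q^ suc b · signedSeries (suc b)
signedSeries-odd b 1+b-odd n = trans (signedSeries-suc b n)
  (cong (signedSeries b n +ℤ_) (trans (cong (λ p → signedSum (enumerateLargest p n b n)) 1+b-odd) (largest n)))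
  where
  largest : ∀ n → signedSum (enumerateLargest 1ℙ n b n) ≡ (q^ suc b · signedSeries (suc b)) n
  largest zero     = refl
  largest (suc n) = trans (signedSum-map-∷-odd (suc b) (enumerate n (suc b) (n ∸ b)) (parity≡1ℙ⇒∤ 1+b-odd))
    (trans (enumerate-fuel n (n ∸ b) (suc b) (n ∸ b) (ℕₚ.m∸n≤m n b) ℕₚ.≤-refl) (sym (shift-signedSeries b (suc b) n)))

-- A largest part suc b that is even occurs once, flips the sign, or is the whole partition.
signedSeries-even : ∀ b → parity (suc b) ≡ 0ℙ → signedSeries (suc b) ≗ ⟨1-q^ suc b ⟩· signedSeries b ⊕ q^ suc b · 1ₛ
signedSeries-even b 1+b-even n = begin
  signedSeries (suc b) n
    ≡⟨ signedSeries-suc b n ⟩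
  V b n +ℤ signedSum (enumerateLargest (parity (suc b)) n b n)
    ≡⟨ cong (λ p → V b n +ℤ signedSum (enumerateLargest p n b n)) 1+b-even ⟩
  V b n +ℤ signedSum (singletonIf (n ℕₚ.≟ suc b) ++ rest)
    ≡⟨ cong (V b n +ℤ_) (signedSum-++ (singletonIf (n ℕₚ.≟ suc b)) rest) ⟩
  V b n +ℤ (signedSum (singletonIf (n ℕₚ.≟ suc b)) +ℤ signedSum rest)
    ≡⟨ cong (V b n +ℤ_) (cong₂ _+ℤ_ (alone (n ℕₚ.≟ suc b)) minus) ⟩
  V b n +ℤ ((q^ suc b · 1ₛ) n +ℤ - (q^ suc b · V b) n)
    ≡⟨ solve 3 (λ v s w → v :+ (s :+ (:- w)) := (v :+ (:- w)) :+ s) refl (V b n) _ _ ⟩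
  (⟨1-q^ suc b ⟩· V b ⊕ q^ suc b · 1ₛ) n ∎
  where
  open ≡-Reasoning
  V = signedSeries
  rest = map (suc b ∷_) (enumerate n b (n ∸ suc b))
  2∣1+b : 2 ∣ suc b
  2∣1+b = parity≡0ℙ⇒∣ (suc b) 1+b-even
  alone : ∀ d → signedSum (singletonIf {suc b} d) ≡ (q^ suc b · 1ₛ) n
  alone (yes refl) = trans (cong (λ k → sgn (suc k) +ℤ 0ℤ) (cong length (filter-accept (2 ∣?_) 2∣1+b)))
                                (sym (shift-1ₛ-diagonal (suc b)))
  alone (no n≢1+b)   = sym (shift-1ₛ-off-diagonal (suc b) n (n≢1+b ∘ sym))

  minus : signedSum rest ≡ - (q^ suc b · V b) n
  minus = trans (signedSum-map-∷-even (suc b) (enumerate n b (n ∸ suc b)) 2∣1+b)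
    (cong -_ (trans (enumerate-fuel n (n ∸ suc b) b (n ∸ suc b) (ℕₚ.m∸n≤m n (suc b)) ℕₚ.≤-refl)
                    (sym (shift-signedSeries (suc b) b n))))

geometric : Series
geometric _ = 1ℤ

geometric≗⁻¹·1ₛ : geometric ≗ ⟨1-q^ 1 ⟩⁻¹· 1ₛ
geometric≗⁻¹·1ₛ = fixpoint-unique-≗ 0 {1ₛ} unfold (⁻¹·-unfold 0 1ₛ)
  where
  unfold : geometric ≗ 1ₛ ⊕ q^ 1 · geometric
  unfold zero    = refl
  unfold (suc n) = refl

geometric-step : ∀ k → ⟨1-q^ suc k ⟩· geometric ⊕ q^ suc k · 1ₛ ≗ ⟨1-q^ suc (suc k) ⟩· geometric
geometric-step k n with ℕₚ.<-cmp n (suc k)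
... | tri< n<1+k _ _ = begin
  (1ℤ +ℤ - (q^ suc k · geometric) n) +ℤ (q^ suc k · 1ₛ) n
    ≡⟨ cong₂ (λ u v → (1ℤ +ℤ - u) +ℤ v) (shift-below (suc k) geometric n n<1+k) (shift-below (suc k) 1ₛ n n<1+k) ⟩
  1ℤ
    ≡⟨ cong (λ u → 1ℤ +ℤ - u) (shift-below (suc (suc k)) geometric n (ℕₚ.m<n⇒m<1+n n<1+k)) ⟨
  1ℤ +ℤ - (q^ suc (suc k) · geometric) n ∎
  where open ≡-Reasoning
... | tri≈ _ refl _ = begin
  (1ℤ +ℤ - (q^ suc k · geometric) (suc k)) +ℤ (q^ suc k · 1ₛ) (suc k)
    ≡⟨ cong₂ (λ u v → (1ℤ +ℤ - u) +ℤ v) (shift-above (suc k) geometric (suc k) ℕₚ.≤-refl) (shift-1ₛ-diagonal (suc k)) ⟩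
  1ℤ
    ≡⟨ cong (λ u → 1ℤ +ℤ - u) (shift-below (suc (suc k)) geometric (suc k) ℕₚ.≤-refl) ⟨
  1ℤ +ℤ - (q^ suc (suc k) · geometric) (suc k) ∎
  where open ≡-Reasoning
... | tri> _ n≢1+k 1+k<n = begin
  (1ℤ +ℤ - (q^ suc k · geometric) n) +ℤ (q^ suc k · 1ₛ) n
    ≡⟨ cong₂ (λ u v → (1ℤ +ℤ - u) +ℤ v) (shift-above (suc k) geometric n (ℕₚ.<⇒≤ 1+k<n))
                                        (shift-1ₛ-off-diagonal (suc k) n (n≢1+k ∘ sym)) ⟩
  0ℤ
    ≡⟨ cong (λ u → 1ℤ +ℤ - u) (shift-above (suc (suc k)) geometric n 1+k<n) ⟨
  1ℤ +ℤ - (q^ suc (suc k) · geometric) n ∎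
  where open ≡-Reasoning

signedSeries-odd-⁻¹ : ∀ b → parity (suc b) ≡ 1ℙ → signedSeries (suc b) ≗ ⟨1-q^ suc b ⟩⁻¹· signedSeries b
signedSeries-odd-⁻¹ b 1+b-odd =
  fixpoint-unique-≗ b {signedSeries b} (signedSeries-odd b 1+b-odd) (⁻¹·-unfold b (signedSeries b))

signedSeries⊕gauss-odd : ∀ b → parity (suc b) ≡ 1ℙ →
  signedSeries (suc b) ⊕ gauss (suc b) 1ₛ ≗ ⟨1-q^ suc b ⟩⁻¹· (signedSeries b ⊕ gauss b 1ₛ)
signedSeries⊕gauss-odd b 1+b-odd = begin
  signedSeries (suc b) ⊕ gauss (suc b) 1ₛ    ≈⟨ ⊕-cong (signedSeries-odd-⁻¹ b 1+b-odd) gauss-odd ⟩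
  D (signedSeries b) ⊕ D (gauss b 1ₛ)        ≈⟨ ⊕-homo (⁻¹·-multiplier (suc b)) (signedSeries b) (gauss b 1ₛ) ⟨
  D (signedSeries b ⊕ gauss b 1ₛ)            ∎
  where
  open ≗-Reasoning
  D = ⟨1-q^ suc b ⟩⁻¹·_
  gauss-odd : gauss (suc b) 1ₛ ≗ D (gauss b 1ₛ)
  gauss-odd rewrite 1+b-odd = ≗-refl

signedSeries⊕gauss-even : ∀ b → parity (suc b) ≡ 0ℙ →
  signedSeries (suc b) ⊕ gauss (suc b) 1ₛ ≗ ⟨1-q^ suc b ⟩· (signedSeries b ⊕ gauss b 1ₛ) ⊕ q^ suc b · 1ₛ
signedSeries⊕gauss-even b 1+b-even = begin
  V (suc b) ⊕ gauss (suc b) 1ₛ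
    ≈⟨ ⊕-cong (signedSeries-even b 1+b-even) gauss-even ⟩
  (⟨1-q^ suc b ⟩· V b ⊕ q^ suc b · 1ₛ) ⊕ ⟨1-q^ suc b ⟩· gauss b 1ₛ
    ≈⟨ ⊕-swapʳ (⟨1-q^ suc b ⟩· V b) (q^ suc b · 1ₛ) (⟨1-q^ suc b ⟩· gauss b 1ₛ) ⟩
  (⟨1-q^ suc b ⟩· V b ⊕ ⟨1-q^ suc b ⟩· gauss b 1ₛ) ⊕ q^ suc b · 1ₛ
    ≈⟨ ⊕-congʳ (q^ suc b · 1ₛ) (⊕-homo (⟨1-q^⟩·-multiplier (suc b)) (V b) (gauss b 1ₛ)) ⟨
  ⟨1-q^ suc b ⟩· (V b ⊕ gauss b 1ₛ) ⊕ q^ suc b · 1ₛ ∎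
  where
  open ≗-Reasoning
  V = signedSeries
  gauss-even : gauss (suc b) 1ₛ ≗ ⟨1-q^ suc b ⟩· gauss b 1ₛ
  gauss-even rewrite 1+b-even = ≗-refl

signedSeries⊕gauss : ∀ c → signedSeries (suc (c + c)) ⊕ gauss (suc (c + c)) 1ₛ ≗ geometric
signedSeries⊕gauss zero = begin
  signedSeries 1 ⊕ gauss 1 1ₛ            ≈⟨ signedSeries⊕gauss-odd 0 refl ⟩
  ⟨1-q^ 1 ⟩⁻¹· (0ₛ ⊕ 1ₛ)                 ≈⟨ preserves-≗ (⁻¹·-multiplier 1) (λ n → ℤₚ.+-identityˡ (1ₛ n)) ⟩
  ⟨1-q^ 1 ⟩⁻¹· 1ₛ                        ≈⟨ geometric≗⁻¹·1ₛ ⟨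
  geometric                              ∎
  where open ≗-Reasoning
signedSeries⊕gauss (suc c) rewrite ℕₚ.+-suc c c = begin
  V (suc (suc b)) ⊕ G (suc (suc b))
    ≈⟨ signedSeries⊕gauss-odd (suc b) (parity-double+1 c) ⟩
  D (V (suc b) ⊕ G (suc b))
    ≈⟨ D-cong (signedSeries⊕gauss-even b (parity-double c)) ⟩
  D (⟨1-q^ suc b ⟩· (V b ⊕ G b) ⊕ q^ suc b · 1ₛ)
    ≈⟨ D-cong (⊕-congʳ (q^ suc b · 1ₛ) (preserves-≗ (⟨1-q^⟩·-multiplier (suc b)) (signedSeries⊕gauss c))) ⟩
  D (⟨1-q^ suc b ⟩· geometric ⊕ q^ suc b · 1ₛ)
    ≈⟨ D-cong (geometric-step b) ⟩
  D (⟨1-q^ suc (suc b) ⟩· geometric)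
    ≈⟨ ⟨1-q^⟩·-inverseˡ (suc b) geometric ⟩
  geometric ∎
  where
  open ≗-Reasoning
  V = signedSeries
  G = λ b → gauss b 1ₛ
  b = suc (c + c)
  D = ⟨1-q^ suc (suc b) ⟩⁻¹·_
  D-cong : ∀ {x y} → x ≗ y → D x ≗ D y
  D-cong = preserves-≗ (⁻¹·-multiplier (suc (suc b)))

parts≤sum : ∀ π → All (_≤ sum π) π
parts≤sum []      = []
parts≤sum (x ∷ π) = ℕₚ.m≤m+n x (sum π) ∷ All.map (λ y≤ → ℕₚ.≤-trans y≤ (ℕₚ.m≤n+m (sum π) x)) (parts≤sum π)

signedSum≡signedSeries : ∀ N b ps → N ≤ b → Unique ps → (∀ π → π ∈ ps ⇔ (InPₑ π × ∣ π ∣ₚ ≡ N)) →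
                         signedSum ps ≡ signedSeries b N
signedSum≡signedSeries N b ps N≤b unique spec = signedSum-set unique (enumerate-unique N b N) λ π →
  mk⇔ (λ π∈ps → let inPₑ , size = Equivalence.to (spec π) π∈ps in
               enumerate-complete (Pₑ-complete b π (inPₑ , size , bounded π size)) N ℕₚ.≤-refl)
      (λ π∈ → let inPₑ , size , _ = Pₑ-sound (enumerate-sound N b N π π∈) in Equivalence.from (spec π) (inPₑ , size))
  where
  bounded : ∀ π → ∣ π ∣ₚ ≡ N → All (_≤ b) π
  bounded π refl = All.map (λ x≤ → ℕₚ.≤-trans x≤ N≤b) (parts≤sum π)

signedSeries-coefficient : ∀ N → signedSeries (suc (N + N)) N ≡ 1ℤ +ℤ - thetaSum N N
signedSeries-coefficient N = begin
  V N
    ≡⟨ solve 2 (λ v g → v := (v :+ g) :+ (:- g)) refl (V N) (G N) ⟩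
  (V N +ℤ G N) +ℤ - G N
    ≡⟨ cong₂ (λ x y → x +ℤ - y) (signedSeries⊕gauss N N) gauss-coefficient ⟩
  1ℤ +ℤ - thetaSum N N ∎
  where
  open ≡-Reasoning
  V = signedSeries (suc (N + N))
  G = gauss (suc (N + N)) 1ₛ
  gauss-coefficient : G N ≡ thetaSum N N
  gauss-coefficient = trans (gauss-≈-truncate (suc (N + N)) N 1ₛ (ℕₚ.m≤n⇒m≤1+n (ℕₚ.m≤m+n N N)) N ℕₚ.≤-refl)
                            (gauss-≈-thetaSum N N ℕₚ.≤-refl)

theorem5p2 : (N : ℕ) → N ≥ 1 → (ps : List (List ℕ)) → Unique ps →
    (∀ π → (π ∈ ps) ⇔ (InPₑ π × ∣ π ∣ₚ ≡ N)) →
    (Triangular N → signedSum ps ≡ + 0) × (¬ Triangular N → signedSum ps ≡ + 1)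
theorem5p2 N _ ps unique spec =
    (λ triangular → let t , tri-t≡N = Triangular⇒tri triangular in
                    trans signedSum≡1-θ (cong (λ θ → 1ℤ +ℤ - θ) (thetaSum-coefficient-triangular N t tri-t≡N)))
  , (λ not-triangular → trans signedSum≡1-θ (cong (λ θ → 1ℤ +ℤ - θ)
                          (thetaSum-coefficient-non-triangular N λ t tri-t≡N → not-triangular (tri⇒Triangular (t , tri-t≡N)))))
  where
  signedSum≡1-θ : signedSum ps ≡ 1ℤ +ℤ - thetaSum N N
  signedSum≡1-θ = trans (signedSum≡signedSeries N (suc (N + N)) ps (ℕₚ.m≤n⇒m≤1+n (ℕₚ.m≤m+n N N)) unique spec)
                        (signedSeries-coefficient N)
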